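{- The map sending $\psi\in\mathfrak{Lie}(B)$ to the linear endomorphism $t\mapsto\sigma^0_\psi\circ t-t\circ\sigma^0_\psi$ of $\mathrm{End}_{\mathbb{Q}}(\mathbb{Q}\langle B\rangle^0)$ is a Lie algebra morphism from $(\mathfrak{Lie}(B),\{ -,-\}_A)$ to $\mathrm{End}_{\mathbb{Q}}(\mathrm{End}_{\mathbb{Q}}(\mathbb{Q}\langle B\rangle^0))$ with commutator bracket; i.e. it is a Lie algebra action of $(\mathfrak{Lie}(B),\{ -,-\}_A)$ on $\mathrm{End}_{\mathbb{Q}}(\mathbb{Q}\langle B\rangle^0)$.
   Context: Let $B=\{b_0,b_1,b_2,\dots\}$, $\mathbb{Q}\langle B\rangle$ the free associative $\mathbb{Q}$-algebra on $B$, and $\mathfrak{Lie}(B)\subset\mathbb{Q}\langle B\rangle$ the free Lie algebra on $B$. Let $\mathbb{Q}\langle B\rangle^0$ be the span of words not ending in $b_0$ and $\pi_0:\mathbb{Q}\langle B\rangle\to\mathbb{Q}\langle B\rangle^0$ the projection killing words ending in $b_0$ and fixing other words. For a word $w=b_0^{m_1}b_{k_1}\cdots b_0^{m_d}b_{k_d}b_0^{m_{d+1}}$ ($d\ge1$, $k_i\ge1$, $m_i\ge0$), $\mathbf{k}=(k_1,\dots,k_d)$ and $\mathbf{l}\in\mathbb{Z}_{>0}^d$, let $w(\mathbf{l})$ be obtained by replacing each $b_{k_i}$ by $b_{l_i}$, $|\mathbf{k}|=\sum k_i$, $\binom{\mathbf{k}-1}{\mathbf{l}-1}=\prod_i\binom{k_i-1}{l_i-1}$,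 $\mathbf{l}\le\mathbf{k}$ componentwise. Let $\partial_w$ be the derivation of $\mathbb{Q}\langle B\rangle$ with $\partial_w(b_0)=0$ and $\partial_w(b_i)=\sum_{\mathbf{l}\le\mathbf{k}}(-1)^{|\mathbf{k}|+|\mathbf{l}|}\binom{\mathbf{k}-1}{\mathbf{l}-1}[b_{i+|\mathbf{k}|-|\mathbf{l}|},w(\mathbf{l})]$ for $i\ge1$; if $w=b_0^m$ ($m\ge1$), $\partial_w(b_0)=0$, $\partial_w(b_i)=[b_i,w]$; extend linearly in $w$. The bracket $\{\psi_1,\psi_2\}_A=\partial_{\psi_1}(\psi_2)-\partial_{\psi_2}(\psi_1)+[\psi_1,\psi_2]$ is a Lie bracket on $\mathfrak{Lie}(B)$. For $\psi\in\mathfrak{Lie}(B)$, $\sigma_\psi=\ell_\psi+\partial_\psi$ ($\ell_\psi$ left multiplication) maps $\mathbb{Q}\langle B\rangle b_0$ into itself, and $\sigma^0_\psi$ is the unique linear endomorphism of $\mathbb{Q}\langle B\rangle^0$ with $\pi_0\circ\sigma_\psi=\sigma^0_\psi\circ\pi_0$. -}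

module Defs where

open import Data.Nat as ℕ using (ℕ; zero; suc; _∸_)
open import Data.Nat.Combinatorics using (_C_)
open import Data.Integer using (+_)
open import Data.Rational using (ℚ; 0ℚ; 1ℚ; _+_; _*_; -_; _/_)
open import Data.List using (List; []; _∷_; _++_; map; concatMap; upTo)
open import Data.List.Properties using (≡-dec)
open import Data.Product using (_×_; _,_)
open import Relation.Nullary using (yes; no)
open import Data.Bool using (Bool; true; false; if_then_else_)
open import Relation.Binary.PropositionalEquality using (_≡_)

-- Words in the alphabet B = {b_0, b_1, ...}: the letter b_i is encoded by i.
Word : Set
Word = List ℕ

-- Elements of ℚ⟨B⟩ as formal finite linear combinations of words.
Poly : Set
Poly = List (ℚ × Word)

coeff : Poly → Word → ℚ
coeff [] w = 0ℚ
coeff ((c , u) ∷ p) w with ≡-dec ℕ._≟_ u w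
... | yes _ = c + coeff p w
... | no _ = coeff p w

infix 4 _≈_
_≈_ : Poly → Poly → Set
p ≈ q = ∀ w → coeff p w ≡ coeff q w

infixl 6 _⊕_
_⊕_ : Poly → Poly → Poly
p ⊕ q = p ++ q

infixr 7 _·_
_·_ : ℚ → Poly → Poly
a · p = map (λ { (c , u) → (a * c , u) }) p

neg : Poly → Poly
neg p = (- 1ℚ) · p

infixl 8 _⊛_
_⊛_ : Poly → Poly → Poly
p ⊛ q = concatMap (λ { (a , u) → map (λ { (b , v) → (a * b , u ++ v) }) q }) p

⟦_,_⟧ : Poly → Poly → Poly
⟦ p , q ⟧ = p ⊛ q ⊕ neg (q ⊛ p)

word : Word → Poly
word w = (1ℚ , w) ∷ []

gen : ℕ → Poly
gen i = word (i ∷ [])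

-- the free Lie algebra Lie(B) ⊂ ℚ⟨B⟩: smallest subspace containing the
-- generators and closed under commutators
data IsLie : Poly → Set where
  lie-gen : ∀ i → IsLie (gen i)
  lie-add : ∀ {p q} → IsLie p → IsLie q → IsLie (p ⊕ q)
  lie-scal : ∀ a {p} → IsLie p → IsLie (a · p)
  lie-brk : ∀ {p q} → IsLie p → IsLie q → IsLie ⟦ p , q ⟧
  lie-resp : ∀ {p q} → p ≈ q → IsLie p → IsLie q

ℕtoℚ : ℕ → ℚ
ℕtoℚ n = + n / 1

sgn : ℕ → ℚ
sgn zero = 1ℚ
sgn (suc n) = - sgn n

-- For a word w with nonzero letters k = (k_1..k_d): list over all l ≤ k
-- (l_i ≥ 1) of ( (-1)^{|k|+|l|} binom(k-1,l-1) , |k|-|l| , w(l) ).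
subs : Word → List (ℚ × ℕ × Word)
subs [] = (1ℚ , 0 , []) ∷ []
subs (zero ∷ w) = map (λ { (c , s , u) → (c , s , zero ∷ u) }) (subs w)
subs (suc k ∷ w) =
  concatMap (λ l → map (λ { (c , s , u) →
      (sgn (k ∸ l) * ℕtoℚ (k C l) * c , (k ∸ l) ℕ.+ s , suc l ∷ u) }) (subs w))
    (upTo (suc k))

-- ∂_w on a letter b_i (for w = b_0^m this gives [b_i , w])
dLetter : Word → ℕ → Poly
dLetter w zero = []
dLetter w (suc i) =
  concatMap (λ { (c , s , u) → c · ⟦ gen (suc i ℕ.+ s) , word u ⟧ }) (subs w)

dWord : Word → Word → Poly
dWord w [] = []
dWord w (a ∷ x) = dLetter w a ⊛ word x ⊕ word (a ∷ []) ⊛ dWord w x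

∂ : Poly → Poly → Poly
∂ ψ p = concatMap (λ { (c , w) → concatMap (λ { (d , x) → (c * d) · dWord w x }) p }) ψ

braceA : Poly → Poly → Poly
braceA ψ₁ ψ₂ = ∂ ψ₁ ψ₂ ⊕ neg (∂ ψ₂ ψ₁) ⊕ ⟦ ψ₁ , ψ₂ ⟧

σ : Poly → Poly → Poly
σ ψ p = ψ ⊛ p ⊕ ∂ ψ p

endsIn0 : Word → Bool
endsIn0 [] = false
endsIn0 (zero ∷ []) = true
endsIn0 (suc _ ∷ []) = false
endsIn0 (_ ∷ b ∷ w) = endsIn0 (b ∷ w)

π₀ : Poly → Poly
π₀ [] = []
π₀ ((c , u) ∷ p) = if endsIn0 u then π₀ p else (c , u) ∷ π₀ p

In0 : Poly → Set
In0 x = π₀ x ≈ x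

-- σ⁰_ψ on ℚ⟨B⟩⁰ : since π₀ is the identity on ℚ⟨B⟩⁰,
-- σ⁰_ψ(x) = σ⁰_ψ(π₀ x) = π₀(σ_ψ x)
σ⁰ : Poly → Poly → Poly
σ⁰ ψ x = π₀ (σ ψ x)

-- linear endomorphisms of ℚ⟨B⟩⁰, represented by maps ℚ⟨B⟩ → ℚ⟨B⟩
-- (only their values on ℚ⟨B⟩⁰ matter)
record IsEnd⁰ (t : Poly → Poly) : Set where
  field
    resp : ∀ {x y} → In0 x → In0 y → x ≈ y → t x ≈ t y
    additive : ∀ x y → In0 x → In0 y → t (x ⊕ y) ≈ t x ⊕ t y
    homog : ∀ a x → In0 x → t (a · x) ≈ a · t x
    into : ∀ x → In0 x → In0 (t x)

Φ : Poly → (Poly → Poly) → (Poly → Poly)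
Φ ψ t x = σ⁰ ψ (t x) ⊕ neg (t (σ⁰ ψ x))

-- Φ ψ is the adjoint action t ↦ [σ⁰_ψ, t], and ad_[S₁,S₂] = [ad_S₁, ad_S₂] for any
-- endomorphisms, so it suffices that ψ ↦ σ⁰_ψ is linear and sends {ψ₁,ψ₂}_A to
-- [σ⁰_ψ₁, σ⁰_ψ₂]. As ∂_ψ b₀ = 0, σ_ψ preserves ℚ⟨B⟩b₀ and the identity descends from σ to
-- σ⁰; as σ_ψ = ℓ_ψ + ∂_ψ with ∂_ψ a derivation, it reduces to ∂_{ψ₁,ψ₂}_A = [∂_ψ₁, ∂_ψ₂].
-- Both sides are derivations and bilinear in (ψ₁, ψ₂), so it is enough to test words x, y
-- on a generator b. There ∂_w b is a signed binomial sum Σsubs w of brackets [b_{i+s}, w(l)],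
-- and the key fact is that Σsubs commutes with ∂_x: the binomial coefficients make two
-- successive index shifts combine like powers of the difference operator E₂ − E₁. This
-- identifies ∂_{∂_x y} b with the part of ∂_x ∂_y b in which ∂_x hits the words, and the
-- Jacobi identity matches ∂_[x,y] b with the part in which it hits the letters.

module Submission where

open import Defs
open import Data.Rational using (ℚ; 0ℚ; 1ℚ; _+_; _*_; -_; mkℚ; toℚᵘ)
open import Data.Product using (_×_; _,_; proj₁; proj₂; Σ)

open import Data.Bool using (true; false; if_then_else_)
open import Data.Empty using (⊥-elim)
open import Data.Fin using (Fin)
import Data.Integer as ℤ
import Data.Integer.Properties as ℤ
open import Data.List using (List; []; _∷_; _++_; map; concatMap; upTo; applyUpTo; length)
open import Data.List.Properties using (≡-dec; map-++; ++-assoc; ++-identityʳ; concatMap-++; concatMap-map)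
open import Data.Nat as ℕ using (ℕ; zero; suc; _∸_) renaming (_+_ to _+ₙ_)
import Data.Nat.Properties as ℕ
open import Data.Nat.Combinatorics using (_C_; nCk+nC[k+1]≡[n+1]C[k+1]; nCn≡1)
import Data.Nat.Coprimality as Coprime
import Data.Rational.Properties as ℚ
open import Data.Rational.Solver using (module +-*-Solver)
import Data.Rational.Unnormalised as ℚᵘ
import Data.Rational.Unnormalised.Properties as ℚᵘ
open import Data.Vec as Vec using (Vec; lookup; allFin)
import Data.Vec.Properties as Vec
open import Data.Vec.N-ary using (N-ary; _$ⁿ_; curryⁿ; Eq; curryⁿ-cong)
open import Function using (_∘_; id)
open import Relation.Binary.Bundles using (Setoid)
open import Relation.Binary.PropositionalEquality using (_≡_; refl; sym; trans; cong; cong₂)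
open import Relation.Nullary using (yes; no; ¬_)

module ℚ-Solver = +-*-Solver

-- ℚ⟨B⟩ as a setoid of formal sums

infix 4 _≋_
-- p ≈ q unfolds to a Π-type from which Agda cannot recover p and q; the
-- record wrapper makes them inferable.
record _≋_ (p q : Poly) : Set where
  constructor ⟨_⟩
  field coeff-≡ : p ≈ q
open _≋_ public

≋-refl : ∀ {p} → p ≋ p
≋-refl = ⟨ (λ _ → refl) ⟩

≋-sym : ∀ {p q} → p ≋ q → q ≋ p
≋-sym ⟨ e ⟩ = ⟨ (λ w → sym (e w)) ⟩

≋-trans : ∀ {p q r} → p ≋ q → q ≋ r → p ≋ r
≋-trans ⟨ e ⟩ ⟨ f ⟩ = ⟨ (λ w → trans (e w) (f w)) ⟩

≡⇒≋ : ∀ {p q} → p ≡ q → p ≋ q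
≡⇒≋ refl = ≋-refl

≋-setoid : Setoid _ _
≋-setoid = record
  { Carrier = Poly
  ; _≈_ = _≋_
  ; isEquivalence = record { refl = ≋-refl ; sym = ≋-sym ; trans = ≋-trans }
  }

open import Relation.Binary.Reasoning.Setoid ≋-setoid

coeff-⊕ : ∀ p q w → coeff (p ⊕ q) w ≡ coeff p w + coeff q w
coeff-⊕ [] q w = sym (ℚ.+-identityˡ _)
coeff-⊕ ((c , u) ∷ p) q w with ≡-dec ℕ._≟_ u w
... | yes _ = trans (cong (c +_) (coeff-⊕ p q w)) (sym (ℚ.+-assoc c _ _))
... | no _ = coeff-⊕ p q w

coeff-· : ∀ a p w → coeff (a · p) w ≡ a * coeff p w
coeff-· a [] w = sym (ℚ.*-zeroʳ a)
coeff-· a ((c , u) ∷ p) w with ≡-dec ℕ._≟_ u w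
... | yes _ = trans (cong (a * c +_) (coeff-· a p w)) (sym (ℚ.*-distribˡ-+ a c _))
... | no _ = coeff-· a p w

⊕-cong : ∀ {p p′ q q′} → p ≋ p′ → q ≋ q′ → p ⊕ q ≋ p′ ⊕ q′
⊕-cong {p} {p′} {q} {q′} ⟨ e ⟩ ⟨ f ⟩ = ⟨ (λ w →
  trans (coeff-⊕ p q w) (trans (cong₂ _+_ (e w) (f w)) (sym (coeff-⊕ p′ q′ w)))) ⟩

·-cong : ∀ a {p q} → p ≋ q → a · p ≋ a · q
·-cong a {p} {q} ⟨ e ⟩ = ⟨ (λ w →
  trans (coeff-· a p w) (trans (cong (a *_) (e w)) (sym (coeff-· a q w)))) ⟩

⊕-congˡ : ∀ {p p′} q → p ≋ p′ → p ⊕ q ≋ p′ ⊕ q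
⊕-congˡ q p≋p′ = ⊕-cong p≋p′ (≋-refl {q})

⊕-congʳ : ∀ p {q q′} → q ≋ q′ → p ⊕ q ≋ p ⊕ q′
⊕-congʳ p = ⊕-cong (≋-refl {p})

neg-cong : ∀ {p q} → p ≋ q → neg p ≋ neg q
neg-cong = ·-cong (- 1ℚ)

·-⊕ : ∀ a p q → a · (p ⊕ q) ≡ a · p ⊕ a · q
·-⊕ a p q = map-++ _ p q

⊕-identityʳ : ∀ p → p ⊕ [] ≡ p
⊕-identityʳ = ++-identityʳ

module LinearSolver where

  infixl 6 _⊞_
  infixr 7 _⊡_
  infix 8 ⊟_
  infix 4 _⊜_

  data LinExpr (n : ℕ) : Set where
    var  : Fin n → LinExpr n
    _⊞_ : LinExpr n → LinExpr n → LinExpr n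
    _⊡_ : ℚ → LinExpr n → LinExpr n
    ⊟_  : LinExpr n → LinExpr n
    ∅   : LinExpr n

  ⟦_⟧ : ∀ {n} → LinExpr n → Vec Poly n → Poly
  ⟦ var i ⟧ ρ = lookup ρ i
  ⟦ e ⊞ f ⟧ ρ = ⟦ e ⟧ ρ ⊕ ⟦ f ⟧ ρ
  ⟦ a ⊡ e ⟧ ρ = a · ⟦ e ⟧ ρ
  ⟦ ⊟ e ⟧ ρ = neg (⟦ e ⟧ ρ)
  ⟦ ∅ ⟧ ρ = []

  open ℚ-Solver using (Polynomial; op; con; [+]; [*]; correct)
    renaming (var to x; ⟦_⟧ to ⟦_⟧ℚ; ⟦_⟧↓ to ⟦_⟧ℚ↓)

  linearise : ∀ {n} → LinExpr n → Polynomial n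
  linearise (var i) = x i
  linearise (e ⊞ f) = op [+] (linearise e) (linearise f)
  linearise (a ⊡ e) = op [*] (con a) (linearise e)
  linearise (⊟ e) = op [*] (con (- 1ℚ)) (linearise e)
  linearise ∅ = con 0ℚ

  coeff-⟦⟧ : ∀ {n} (e : LinExpr n) ρ w →
             coeff (⟦ e ⟧ ρ) w ≡ ⟦ linearise e ⟧ℚ (Vec.map (λ p → coeff p w) ρ)
  coeff-⟦⟧ (var i) ρ w = sym (Vec.lookup-map i _ ρ)
  coeff-⟦⟧ (e ⊞ f) ρ w = trans (coeff-⊕ (⟦ e ⟧ ρ) (⟦ f ⟧ ρ) w) (cong₂ _+_ (coeff-⟦⟧ e ρ w) (coeff-⟦⟧ f ρ w))
  coeff-⟦⟧ (a ⊡ e) ρ w = trans (coeff-· a (⟦ e ⟧ ρ) w) (cong (a *_) (coeff-⟦⟧ e ρ w))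
  coeff-⟦⟧ (⊟ e) ρ w = trans (coeff-· (- 1ℚ) (⟦ e ⟧ ρ) w) (cong (- 1ℚ *_) (coeff-⟦⟧ e ρ w))
  coeff-⟦⟧ ∅ ρ w = refl

  -- An identity between linear combinations holds in ℚ⟨B⟩ as soon as it holds
  -- coefficientwise, which the ring solver decides.
  prove : ∀ {n} (e f : LinExpr n) ρ →
          (∀ ς → ⟦ linearise e ⟧ℚ↓ ς ≡ ⟦ linearise f ⟧ℚ↓ ς) → ⟦ e ⟧ ρ ≋ ⟦ f ⟧ ρ
  prove e f ρ hyp = ⟨ (λ w → let ς = Vec.map (λ p → coeff p w) ρ in
    trans (coeff-⟦⟧ e ρ w) (trans (sym (correct (linearise e) ς))
      (trans (hyp ς) (trans (correct (linearise f) ς) (sym (coeff-⟦⟧ f ρ w)))))) ⟩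

  close : ∀ {A : Set} n → N-ary n (LinExpr n) A → A
  close n f = f $ⁿ Vec.map var (allFin n)

  _⊜_ : ∀ {n} → LinExpr n → LinExpr n → LinExpr n × LinExpr n
  _⊜_ = _,_

  solve : ∀ n (f : N-ary n (LinExpr n) (LinExpr n × LinExpr n)) →
          (∀ ς → ⟦ linearise (proj₁ (close n f)) ⟧ℚ↓ ς ≡ ⟦ linearise (proj₂ (close n f)) ⟧ℚ↓ ς) →
          Eq n _≋_ (curryⁿ ⟦ proj₁ (close n f) ⟧) (curryⁿ ⟦ proj₂ (close n f) ⟧)
  solve n f hyp = curryⁿ-cong _≋_ _ _ (λ ρ → prove (proj₁ (close n f)) (proj₂ (close n f)) ρ hyp)

open LinearSolver using (_⊜_; _⊞_; _⊡_; ⊟_; ∅) renaming (solve to ≋-solve)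

⊕-interchange : ∀ p q r s → (p ⊕ q) ⊕ (r ⊕ s) ≋ (p ⊕ r) ⊕ (q ⊕ s)
⊕-interchange = ≋-solve 4 (λ p q r s → (p ⊞ q) ⊞ (r ⊞ s) ⊜ (p ⊞ r) ⊞ (q ⊞ s)) (λ _ → refl)

·-assoc : ∀ a b p → a · (b · p) ≋ (a * b) · p
·-assoc a b p = ⟨ (λ w → trans (coeff-· a (b · p) w) (trans (cong (a *_) (coeff-· b p w))
  (trans (sym (ℚ.*-assoc a b _)) (sym (coeff-· (a * b) p w))))) ⟩

·-comm : ∀ a b p → a · (b · p) ≋ b · (a · p)
·-comm a b p = begin
  a · (b · p)  ≈⟨ ·-assoc a b p ⟩
  (a * b) · p  ≡⟨ cong (_· p) (ℚ.*-comm a b) ⟩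
  (b * a) · p  ≈⟨ ·-assoc b a p ⟨
  b · (a · p)  ∎

·-identityˡ : ∀ p → 1ℚ · p ≋ p
·-identityˡ p = ⟨ (λ w → trans (coeff-· 1ℚ p w) (ℚ.*-identityˡ _)) ⟩

·-zeroˡ : ∀ p → 0ℚ · p ≋ []
·-zeroˡ p = ⟨ (λ w → trans (coeff-· 0ℚ p w) (ℚ.*-zeroˡ (coeff p w))) ⟩

·-distribʳ : ∀ a b p → (a + b) · p ≋ a · p ⊕ b · p
·-distribʳ a b p = ⟨ (λ w → trans (coeff-· (a + b) p w) (trans (ℚ.*-distribʳ-+ _ a b)
  (sym (trans (coeff-⊕ (a · p) (b · p) w) (cong₂ _+_ (coeff-· a p w) (coeff-· b p w)))))) ⟩

-‿· : ∀ c p → (- c) · p ≋ neg (c · p)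
-‿· c p = begin
  (- c) · p         ≡⟨ cong (λ z → (- z) · p) (ℚ.*-identityˡ c) ⟨
  (- (1ℚ * c)) · p  ≡⟨ cong (_· p) (ℚ.neg-distribˡ-* 1ℚ c) ⟩
  (- 1ℚ * c) · p    ≈⟨ ·-assoc (- 1ℚ) c p ⟨
  neg (c · p)       ∎

singleton-cong : ∀ {c d} u → c ≡ d → ((c , u) ∷ []) ≋ ((d , u) ∷ [])
singleton-cong u refl = ≋-refl

module _ {A : Set} where

  concatMap-cong≋ : ∀ {f g : A → Poly} xs → (∀ x → f x ≋ g x) → concatMap f xs ≋ concatMap g xs
  concatMap-cong≋ [] h = ≋-refl
  concatMap-cong≋ (x ∷ xs) h = ⊕-cong (h x) (concatMap-cong≋ xs h)

  concatMap-⊕ : ∀ (f g : A → Poly) xs →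
                concatMap (λ x → f x ⊕ g x) xs ≋ concatMap f xs ⊕ concatMap g xs
  concatMap-⊕ f g [] = ≋-refl
  concatMap-⊕ f g (x ∷ xs) = begin
    (f x ⊕ g x) ⊕ concatMap (λ x → f x ⊕ g x) xs
      ≈⟨ ⊕-cong ≋-refl (concatMap-⊕ f g xs) ⟩
    (f x ⊕ g x) ⊕ (concatMap f xs ⊕ concatMap g xs)
      ≈⟨ ⊕-interchange (f x) (g x) _ _ ⟩
    concatMap f (x ∷ xs) ⊕ concatMap g (x ∷ xs) ∎

  concatMap-· : ∀ a (f : A → Poly) xs → concatMap (λ x → a · f x) xs ≋ a · concatMap f xs
  concatMap-· a f [] = ≋-refl
  concatMap-· a f (x ∷ xs) =
    ≋-trans (⊕-cong ≋-refl (concatMap-· a f xs)) (≡⇒≋ (sym (·-⊕ a (f x) _)))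

  concatMap-[] : ∀ (xs : List A) → concatMap {B = ℚ × Word} (λ _ → []) xs ≡ []
  concatMap-[] [] = refl
  concatMap-[] (x ∷ xs) = concatMap-[] xs

module _ {A B : Set} where

  concatMap-comm : ∀ (f : A → B → Poly) xs ys →
    concatMap (λ x → concatMap (f x) ys) xs ≋ concatMap (λ y → concatMap (λ x → f x y) xs) ys
  concatMap-comm f [] ys = ≡⇒≋ (sym (concatMap-[] ys))
  concatMap-comm f (x ∷ xs) ys = ≋-trans (⊕-cong ≋-refl (concatMap-comm f xs ys))
    (≋-sym (concatMap-⊕ (f x) (λ y → concatMap (λ x → f x y) xs) ys))

  concatMap-concatMap : ∀ (f : B → Poly) (g : A → List B) xs →
    concatMap f (concatMap g xs) ≡ concatMap (λ x → concatMap f (g x)) xs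
  concatMap-concatMap f g [] = refl
  concatMap-concatMap f g (x ∷ xs) =
    trans (concatMap-++ f (g x) (concatMap g xs)) (cong (concatMap f (g x) ++_) (concatMap-concatMap f g xs))

-- Linear extension of maps defined on words

linForm : (Word → ℚ) → Poly → ℚ
linForm g [] = 0ℚ
linForm g ((c , u) ∷ p) = c * g u + linForm g p

linForm-⊕ : ∀ g p q → linForm g (p ⊕ q) ≡ linForm g p + linForm g q
linForm-⊕ g [] q = sym (ℚ.+-identityˡ _)
linForm-⊕ g ((c , u) ∷ p) q =
  trans (cong (c * g u +_) (linForm-⊕ g p q)) (sym (ℚ.+-assoc (c * g u) _ _))

linForm-· : ∀ g a p → linForm g (a · p) ≡ a * linForm g p
linForm-· g a [] = sym (ℚ.*-zeroʳ a)
linForm-· g a ((c , u) ∷ p) = trans (cong₂ _+_ (ℚ.*-assoc a c (g u)) (linForm-· g a p))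
  (sym (ℚ.*-distribˡ-+ a (c * g u) _))

erase : Word → Poly → Poly
erase u [] = []
erase u ((c , x) ∷ p) with ≡-dec ℕ._≟_ x u
... | yes _ = erase u p
... | no _ = (c , x) ∷ erase u p

linForm-erase : ∀ g u p → linForm g p ≡ coeff p u * g u + linForm g (erase u p)
linForm-erase g u [] = sym (trans (ℚ.+-identityʳ _) (ℚ.*-zeroˡ (g u)))
linForm-erase g u ((c , x) ∷ p) with ≡-dec ℕ._≟_ x u
... | yes refl = trans (cong (c * g x +_) (linForm-erase g x p))
      (solve 4 (λ c g a b → c :* g :+ (a :* g :+ b) := (c :+ a) :* g :+ b) refl
        c (g x) (coeff p x) (linForm g (erase x p)))
  where open ℚ-Solver
... | no _ = trans (cong (c * g x +_) (linForm-erase g u p))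
      (solve 3 (λ c a b → c :+ (a :+ b) := a :+ (c :+ b)) refl
        (c * g x) (coeff p u * g u) (linForm g (erase u p)))
  where open ℚ-Solver

coeff-erase-self : ∀ u p → coeff (erase u p) u ≡ 0ℚ
coeff-erase-self u [] = refl
coeff-erase-self u ((c , x) ∷ p) with ≡-dec ℕ._≟_ x u
... | yes _ = coeff-erase-self u p
... | no x≢u with ≡-dec ℕ._≟_ x u
...   | yes x≡u = ⊥-elim (x≢u x≡u)
...   | no _ = coeff-erase-self u p

coeff-erase-other : ∀ u p w → ¬ (w ≡ u) → coeff (erase u p) w ≡ coeff p w
coeff-erase-other u [] w w≢u = refl
coeff-erase-other u ((c , x) ∷ p) w w≢u with ≡-dec ℕ._≟_ x u
... | yes refl with ≡-dec ℕ._≟_ x w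
...   | yes refl = ⊥-elim (w≢u refl)
...   | no _ = coeff-erase-other u p w w≢u
coeff-erase-other u ((c , x) ∷ p) w w≢u | no _ with ≡-dec ℕ._≟_ x w
...   | yes _ = cong (c +_) (coeff-erase-other u p w w≢u)
...   | no _ = coeff-erase-other u p w w≢u

length-erase : ∀ u p → length (erase u p) ℕ.≤ length p
length-erase u [] = ℕ.z≤n
length-erase u ((c , x) ∷ p) with ≡-dec ℕ._≟_ x u
... | yes _ = ℕ.m≤n⇒m≤1+n (length-erase u p)
... | no _ = ℕ.s≤s (length-erase u p)

erase-head : ∀ c u p → erase u ((c , u) ∷ p) ≡ erase u p
erase-head c u p with ≡-dec ℕ._≟_ u u
... | yes _ = refl
... | no u≢u = ⊥-elim (u≢u refl)

-- Induction on the length of the formal sum: erasing its first word keeps it null.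
linForm-null : ∀ g n p → length p ℕ.≤ n → p ≈ [] → linForm g p ≡ 0ℚ
linForm-null g n [] _ _ = refl
linForm-null g (suc n) ((c , u) ∷ p) (ℕ.s≤s len≤n) p≈[] =
  trans (linForm-erase g u ((c , u) ∷ p))
    (cong₂ _+_ (trans (cong (_* g u) (p≈[] u)) (ℚ.*-zeroˡ (g u)))
               (trans (cong (linForm g) (erase-head c u p))
                      (linForm-null g n (erase u p) (ℕ.≤-trans (length-erase u p) len≤n) erased≈[])))
  where
  erased≈[] : erase u p ≈ []
  erased≈[] w with ≡-dec ℕ._≟_ w u
  ... | yes refl = coeff-erase-self w p
  ... | no w≢u = trans (coeff-erase-other u p w w≢u) (trans coeff-tail (p≈[] w))
    where
    coeff-tail : coeff p w ≡ coeff ((c , u) ∷ p) w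
    coeff-tail with ≡-dec ℕ._≟_ u w
    ... | yes u≡w = ⊥-elim (w≢u (sym u≡w))
    ... | no _ = refl

linForm-resp : ∀ g {p q} → p ≋ q → linForm g p ≡ linForm g q
linForm-resp g {p} {q} ⟨ p≈q ⟩ =
  trans (solve 2 (λ a b → a := (a :+ con (- 1ℚ) :* b) :+ b) refl (linForm g p) (linForm g q))
  (trans (cong (_+ linForm g q) (trans (cong (linForm g p +_) (sym (linForm-· g (- 1ℚ) q)))
     (trans (sym (linForm-⊕ g p (neg q))) (linForm-null g _ (p ⊕ neg q) ℕ.≤-refl difference≈[]))))
   (ℚ.+-identityˡ _))
  where
  open ℚ-Solver
  difference≈[] : p ⊕ neg q ≈ []
  difference≈[] w = trans (coeff-⊕ p (neg q) w) (trans (cong₂ _+_ (p≈q w) (coeff-· (- 1ℚ) q w))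
    (solve 1 (λ a → a :+ con (- 1ℚ) :* a := con 0ℚ) refl (coeff q w)))

scaled : (Word → Poly) → ℚ × Word → Poly
scaled f (c , u) = c · f u

extend : (Word → Poly) → Poly → Poly
extend f = concatMap (scaled f)

coeff-extend : ∀ f p w → coeff (extend f p) w ≡ linForm (λ u → coeff (f u) w) p
coeff-extend f [] w = refl
coeff-extend f ((c , u) ∷ p) w =
  trans (coeff-⊕ (c · f u) (extend f p) w) (cong₂ _+_ (coeff-· c (f u) w) (coeff-extend f p w))

extend-resp : ∀ f {p q} → p ≋ q → extend f p ≋ extend f q
extend-resp f {p} {q} p≋q = ⟨ (λ w →
  trans (coeff-extend f p w) (trans (linForm-resp _ p≋q) (sym (coeff-extend f q w)))) ⟩

extend-cong : ∀ {f g} p → (∀ u → f u ≋ g u) → extend f p ≋ extend g p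
extend-cong p f≋g = concatMap-cong≋ p (λ { (c , u) → ·-cong c (f≋g u) })

extend-⊕ : ∀ f p q → extend f (p ⊕ q) ≋ extend f p ⊕ extend f q
extend-⊕ f p q = ≡⇒≋ (concatMap-++ (scaled f) p q)

extend-· : ∀ f a p → extend f (a · p) ≋ a · extend f p
extend-· f a p = begin
  extend f (a · p)                                 ≡⟨ concatMap-map (scaled f) _ p ⟩
  concatMap (λ { (c , u) → (a * c) · f u }) p      ≈⟨ concatMap-cong≋ p (λ { (c , u) → ·-assoc a c (f u) }) ⟨
  concatMap (λ { (c , u) → a · (c · f u) }) p      ≈⟨ concatMap-· a (scaled f) p ⟩
  a · extend f p                                   ∎

extend-word : ∀ f u → extend f (word u) ≋ f u
extend-word f u = ≋-trans (≡⇒≋ (⊕-identityʳ (1ℚ · f u))) (·-identityˡ (f u))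

extend-⊕ᶠ : ∀ f g p → extend (λ u → f u ⊕ g u) p ≋ extend f p ⊕ extend g p
extend-⊕ᶠ f g p = ≋-trans (concatMap-cong≋ p (λ { (c , u) → ≡⇒≋ (·-⊕ c (f u) (g u)) }))
                          (concatMap-⊕ (scaled f) (scaled g) p)

extend-·ᶠ : ∀ a f p → extend (λ u → a · f u) p ≋ a · extend f p
extend-·ᶠ a f p = ≋-trans (concatMap-cong≋ p (λ { (c , u) → ·-comm c a (f u) }))
                          (concatMap-· a (scaled f) p)

extend-[]ᶠ : ∀ p → extend (λ _ → []) p ≋ []
extend-[]ᶠ [] = ≋-refl
extend-[]ᶠ (x ∷ p) = extend-[]ᶠ p

extend-extend : ∀ f g p → extend f (extend g p) ≋ extend (λ u → extend f (g u)) p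
extend-extend f g p = ≋-trans (≡⇒≋ (concatMap-concatMap (scaled f) (scaled g) p))
                              (concatMap-cong≋ p (λ { (c , u) → extend-· f c (g u) }))

record IsLinear (F : Poly → Poly) : Set where
  field
    ≋-resp : ∀ {p q} → p ≋ q → F p ≋ F q
    ⊕-hom  : ∀ p q → F (p ⊕ q) ≋ F p ⊕ F q
    ·-hom  : ∀ a p → F (a · p) ≋ a · F p
open IsLinear public

[]-hom : ∀ {F} → IsLinear F → F [] ≋ []
[]-hom {F} L = ≋-trans (·-hom L 0ℚ []) (·-zeroˡ (F []))

linear≋extend : ∀ {F} → IsLinear F → ∀ p → F p ≋ extend (F ∘ word) p
linear≋extend L [] = []-hom L
linear≋extend {F} L ((c , u) ∷ p) = begin
  F ((c , u) ∷ p)                 ≈⟨ ⊕-hom L ((c , u) ∷ []) p ⟩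
  F ((c , u) ∷ []) ⊕ F p          ≈⟨ ⊕-cong (≋-resp L (singleton-cong u (sym (ℚ.*-identityʳ c)))) ≋-refl ⟩
  F (c · word u) ⊕ F p            ≈⟨ ⊕-cong (·-hom L c (word u)) (linear≋extend L p) ⟩
  extend (F ∘ word) ((c , u) ∷ p) ∎

linear-ext : ∀ {F G} → IsLinear F → IsLinear G → (∀ u → F (word u) ≋ G (word u)) → ∀ p → F p ≋ G p
linear-ext LF LG F≋G p =
  ≋-trans (linear≋extend LF p) (≋-trans (extend-cong p F≋G) (≋-sym (linear≋extend LG p)))

linear-resp-≋ : ∀ {F G} → IsLinear F → (∀ p → F p ≋ G p) → IsLinear G
linear-resp-≋ {F} {G} L F≋G = record
  { ≋-resp = λ {p} {q} p≋q → ≋-trans (≋-sym (F≋G p)) (≋-trans (≋-resp L p≋q) (F≋G q))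
  ; ⊕-hom = λ p q → ≋-trans (≋-sym (F≋G (p ⊕ q))) (≋-trans (⊕-hom L p q) (⊕-cong (F≋G p) (F≋G q)))
  ; ·-hom = λ a p → ≋-trans (≋-sym (F≋G (a · p))) (≋-trans (·-hom L a p) (·-cong a (F≋G p)))
  }

extend-linear : ∀ f → IsLinear (extend f)
extend-linear f = record { ≋-resp = extend-resp f ; ⊕-hom = extend-⊕ f ; ·-hom = extend-· f }

id-linear : IsLinear id
id-linear = record { ≋-resp = id ; ⊕-hom = λ _ _ → ≋-refl ; ·-hom = λ _ _ → ≋-refl }

∘-linear : ∀ {F G} → IsLinear F → IsLinear G → IsLinear (F ∘ G)
∘-linear {F} {G} LF LG = record
  { ≋-resp = ≋-resp LF ∘ ≋-resp LG
  ; ⊕-hom = λ p q → ≋-trans (≋-resp LF (⊕-hom LG p q)) (⊕-hom LF (G p) (G q))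
  ; ·-hom = λ a p → ≋-trans (≋-resp LF (·-hom LG a p)) (·-hom LF a (G p))
  }

⊕-linear : ∀ {F G} → IsLinear F → IsLinear G → IsLinear (λ p → F p ⊕ G p)
⊕-linear {F} {G} LF LG = record
  { ≋-resp = λ p≋q → ⊕-cong (≋-resp LF p≋q) (≋-resp LG p≋q)
  ; ⊕-hom = λ p q → ≋-trans (⊕-cong (⊕-hom LF p q) (⊕-hom LG p q)) (⊕-interchange (F p) (F q) (G p) (G q))
  ; ·-hom = λ a p → ≋-trans (⊕-cong (·-hom LF a p) (·-hom LG a p)) (≡⇒≋ (sym (·-⊕ a (F p) (G p))))
  }

·-linear : ∀ b {F} → IsLinear F → IsLinear (λ p → b · F p)
·-linear b {F} LF = record
  { ≋-resp = ·-cong b ∘ ≋-resp LF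
  ; ⊕-hom = λ p q → ≋-trans (·-cong b (⊕-hom LF p q)) (≡⇒≋ (·-⊕ b (F p) (F q)))
  ; ·-hom = λ a p → ≋-trans (·-cong b (·-hom LF a p)) (·-comm b a (F p))
  }

neg-linear : ∀ {F} → IsLinear F → IsLinear (neg ∘ F)
neg-linear = ·-linear (- 1ℚ)

linear-concatMap : ∀ {A : Set} {F} → IsLinear F → ∀ (f : A → Poly) xs →
                   F (concatMap f xs) ≋ concatMap (F ∘ f) xs
linear-concatMap L f [] = []-hom L
linear-concatMap L f (x ∷ xs) = ≋-trans (⊕-hom L (f x) _) (⊕-cong ≋-refl (linear-concatMap L f xs))

linear-extend : ∀ {F} → IsLinear F → ∀ f p → F (extend f p) ≋ extend (F ∘ f) p
linear-extend L f p = ≋-trans (linear-concatMap L (scaled f) p)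
                              (concatMap-cong≋ p (λ { (c , u) → ·-hom L c (f u) }))

-- The product

prefix : Word → Poly → Poly
prefix u = extend (λ v → word (u ++ v))

⊛≋extend : ∀ p q → p ⊛ q ≋ extend (λ u → prefix u q) p
⊛≋extend p q = concatMap-cong≋ p (λ { (a , u) → row a u q })
  where
  row : ∀ a u q → map (λ { (b , v) → (a * b , u ++ v) }) q ≋ a · prefix u q
  row a u [] = ≋-refl
  row a u ((b , v) ∷ q) =
    ⊕-cong (singleton-cong (u ++ v) (cong (a *_) (sym (ℚ.*-identityʳ b)))) (row a u q)

⊛-congˡ : ∀ {p p′} q → p ≋ p′ → p ⊛ q ≋ p′ ⊛ q
⊛-congˡ {p} {p′} q p≋p′ =
  ≋-trans (⊛≋extend p q) (≋-trans (extend-resp (λ u → prefix u q) p≋p′) (≋-sym (⊛≋extend p′ q)))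

⊛-congʳ : ∀ p {q q′} → q ≋ q′ → p ⊛ q ≋ p ⊛ q′
⊛-congʳ p {q} {q′} q≋q′ = ≋-trans (⊛≋extend p q)
  (≋-trans (extend-cong p (λ u → extend-resp (λ v → word (u ++ v)) q≋q′)) (≋-sym (⊛≋extend p q′)))

⊛-distribʳ : ∀ p p′ q → (p ⊕ p′) ⊛ q ≋ p ⊛ q ⊕ p′ ⊛ q
⊛-distribʳ p p′ q = ≡⇒≋ (concatMap-++ _ p p′)

⊛-distribˡ : ∀ p q q′ → p ⊛ (q ⊕ q′) ≋ p ⊛ q ⊕ p ⊛ q′
⊛-distribˡ p q q′ = begin
  p ⊛ (q ⊕ q′)
    ≈⟨ ⊛≋extend p (q ⊕ q′) ⟩
  extend (λ u → prefix u (q ⊕ q′)) p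
    ≈⟨ extend-cong p (λ u → extend-⊕ (λ v → word (u ++ v)) q q′) ⟩
  extend (λ u → prefix u q ⊕ prefix u q′) p
    ≈⟨ extend-⊕ᶠ (λ u → prefix u q) (λ u → prefix u q′) p ⟩
  extend (λ u → prefix u q) p ⊕ extend (λ u → prefix u q′) p
    ≈⟨ ⊕-cong (⊛≋extend p q) (⊛≋extend p q′) ⟨
  p ⊛ q ⊕ p ⊛ q′ ∎

⊛-·ˡ : ∀ a p q → (a · p) ⊛ q ≋ a · (p ⊛ q)
⊛-·ˡ a p q = ≋-trans (⊛≋extend (a · p) q)
  (≋-trans (extend-· (λ u → prefix u q) a p) (·-cong a (≋-sym (⊛≋extend p q))))

⊛-·ʳ : ∀ a p q → p ⊛ (a · q) ≋ a · (p ⊛ q)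
⊛-·ʳ a p q = ≋-trans (⊛≋extend p (a · q)) (≋-trans (extend-cong p (λ u → extend-· (λ v → word (u ++ v)) a q))
  (≋-trans (extend-·ᶠ a (λ u → prefix u q) p) (·-cong a (≋-sym (⊛≋extend p q)))))

⊛-zeroʳ : ∀ p → p ⊛ [] ≋ []
⊛-zeroʳ p = ≋-trans (⊛≋extend p []) (extend-[]ᶠ p)

word-⊛ : ∀ u q → word u ⊛ q ≋ prefix u q
word-⊛ u q = ≋-trans (⊛≋extend (word u) q) (extend-word (λ u → prefix u q) u)

⊛-word : ∀ p v → p ⊛ word v ≋ extend (λ u → word (u ++ v)) p
⊛-word p v = ≋-trans (⊛≋extend p (word v)) (extend-cong p (λ u → extend-word (λ v → word (u ++ v)) v))

word-⊛-word : ∀ u v → word u ⊛ word v ≋ word (u ++ v)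
word-⊛-word u v = ≋-trans (word-⊛ u (word v)) (extend-word (λ v → word (u ++ v)) v)

prefix-prefix : ∀ u v r → prefix u (prefix v r) ≋ prefix (u ++ v) r
prefix-prefix u v r = ≋-trans (extend-extend (λ x → word (u ++ x)) (λ y → word (v ++ y)) r) (extend-cong r (λ y →
  ≋-trans (extend-word (λ x → word (u ++ x)) (v ++ y)) (≡⇒≋ (cong word (sym (++-assoc u v y))))))

⊛-assoc : ∀ p q r → (p ⊛ q) ⊛ r ≋ p ⊛ (q ⊛ r)
⊛-assoc p q r = begin
  (p ⊛ q) ⊛ r
    ≈⟨ ⊛≋extend (p ⊛ q) r ⟩
  extend (λ x → prefix x r) (p ⊛ q)
    ≈⟨ extend-resp (λ x → prefix x r) (⊛≋extend p q) ⟩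
  extend (λ x → prefix x r) (extend (λ u → prefix u q) p)
    ≈⟨ extend-extend (λ x → prefix x r) (λ u → prefix u q) p ⟩
  extend (λ u → extend (λ x → prefix x r) (prefix u q)) p
    ≈⟨ extend-cong p (λ u → extend-extend (λ x → prefix x r) (λ v → word (u ++ v)) q) ⟩
  extend (λ u → extend (λ v → extend (λ x → prefix x r) (word (u ++ v))) q) p
    ≈⟨ extend-cong p (λ u → extend-cong q (λ v → ≋-trans (extend-word (λ x → prefix x r) (u ++ v))
                                                          (≋-sym (prefix-prefix u v r)))) ⟩
  extend (λ u → extend (λ v → prefix u (prefix v r)) q) p
    ≈⟨ extend-cong p (λ u → linear-extend (extend-linear (λ v → word (u ++ v))) (λ v → prefix v r) q) ⟨
  extend (λ u → prefix u (extend (λ v → prefix v r) q)) p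
    ≈⟨ extend-cong p (λ u → extend-resp (λ v → word (u ++ v)) (⊛≋extend q r)) ⟨
  extend (λ u → prefix u (q ⊛ r)) p
    ≈⟨ ⊛≋extend p (q ⊛ r) ⟨
  p ⊛ (q ⊛ r) ∎

extend-word-id : ∀ q → extend word q ≋ q
extend-word-id q = ≋-sym (linear≋extend id-linear q)

word[]-⊛ : ∀ q → word [] ⊛ q ≋ q
word[]-⊛ q = ≋-trans (word-⊛ [] q) (extend-word-id q)

⊛-word[] : ∀ p → p ⊛ word [] ≋ p
⊛-word[] p = ≋-trans (⊛-word p [])
  (≋-trans (extend-cong p (λ u → ≡⇒≋ (cong word (++-identityʳ u)))) (extend-word-id p))

⊛ˡ-linear : ∀ q → IsLinear (_⊛ q)
⊛ˡ-linear q = record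
  { ≋-resp = ⊛-congˡ q ; ⊕-hom = λ p p′ → ⊛-distribʳ p p′ q ; ·-hom = λ a p → ⊛-·ˡ a p q }

⊛ʳ-linear : ∀ p → IsLinear (p ⊛_)
⊛ʳ-linear p = record { ≋-resp = ⊛-congʳ p ; ⊕-hom = ⊛-distribˡ p ; ·-hom = λ a q → ⊛-·ʳ a p q }

⊛-negˡ : ∀ p q → neg p ⊛ q ≋ neg (p ⊛ q)
⊛-negˡ = ⊛-·ˡ (- 1ℚ)

⊛-negʳ : ∀ p q → p ⊛ neg q ≋ neg (p ⊛ q)
⊛-negʳ = ⊛-·ʳ (- 1ℚ)

⟦⟧-congˡ : ∀ {p p′} q → p ≋ p′ → ⟦ p , q ⟧ ≋ ⟦ p′ , q ⟧
⟦⟧-congˡ q p≋p′ = ⊕-cong (⊛-congˡ q p≋p′) (neg-cong (⊛-congʳ q p≋p′))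

⟦⟧-congʳ : ∀ p {q q′} → q ≋ q′ → ⟦ p , q ⟧ ≋ ⟦ p , q′ ⟧
⟦⟧-congʳ p q≋q′ = ⊕-cong (⊛-congʳ p q≋q′) (neg-cong (⊛-congˡ p q≋q′))

⟦⟧ˡ-linear : ∀ q → IsLinear (λ p → ⟦ p , q ⟧)
⟦⟧ˡ-linear q = ⊕-linear (⊛ˡ-linear q) (neg-linear (⊛ʳ-linear q))

⟦⟧ʳ-linear : ∀ p → IsLinear (λ q → ⟦ p , q ⟧)
⟦⟧ʳ-linear p = ⊕-linear (⊛ʳ-linear p) (neg-linear (⊛ˡ-linear p))

-- The derivations ∂_ψ

dWord-++ : ∀ w u v → dWord w (u ++ v) ≋ dWord w u ⊛ word v ⊕ word u ⊛ dWord w v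
dWord-++ w [] v = ≋-sym (word[]-⊛ (dWord w v))
dWord-++ w (a ∷ u) v = begin
  dLetter w a ⊛ word (u ++ v) ⊕ word (a ∷ []) ⊛ dWord w (u ++ v)
    ≈⟨ ⊕-cong (⊛-congʳ (dLetter w a) (≋-sym (word-⊛-word u v)))
              (⊛-congʳ (word (a ∷ [])) (dWord-++ w u v)) ⟩
  dLetter w a ⊛ (word u ⊛ word v) ⊕ word (a ∷ []) ⊛ (dWord w u ⊛ word v ⊕ word u ⊛ dWord w v)
    ≈⟨ ⊕-cong (≋-sym (⊛-assoc (dLetter w a) (word u) (word v)))
              (≋-trans (⊛-distribˡ (word (a ∷ [])) (dWord w u ⊛ word v) (word u ⊛ dWord w v))
                       (⊕-cong (≋-sym (⊛-assoc (word (a ∷ [])) (dWord w u) (word v)))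
                               (≋-sym (⊛-assoc (word (a ∷ [])) (word u) (dWord w v))))) ⟩
  X ⊕ (Y ⊕ Z)
    ≈⟨ ≋-solve 3 (λ x y z → x ⊞ (y ⊞ z) ⊜ (x ⊞ y) ⊞ z) (λ _ → refl) X Y Z ⟩
  (X ⊕ Y) ⊕ Z
    ≈⟨ ⊕-cong (⊛-distribʳ (dLetter w a ⊛ word u) (word (a ∷ []) ⊛ dWord w u) (word v))
              (⊛-congˡ (dWord w v) (≋-sym (word-⊛-word (a ∷ []) u))) ⟨
  dWord w (a ∷ u) ⊛ word v ⊕ word (a ∷ u) ⊛ dWord w v ∎
  where
  X = (dLetter w a ⊛ word u) ⊛ word v
  Y = (word (a ∷ []) ⊛ dWord w u) ⊛ word v
  Z = (word (a ∷ []) ⊛ word u) ⊛ dWord w v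

∂≋extend : ∀ ψ p → ∂ ψ p ≋ extend (λ w → extend (dWord w) p) ψ
∂≋extend ψ p = concatMap-cong≋ ψ (λ { (c , w) →
  ≋-trans (concatMap-cong≋ p (λ { (d , x) → ≋-sym (·-assoc c d (dWord w x)) }))
          (concatMap-· c (scaled (dWord w)) p) })

∂-linearʳ : ∀ ψ → IsLinear (∂ ψ)
∂-linearʳ ψ = linear-resp-≋ (record
  { ≋-resp = λ p≋q → extend-cong ψ (λ w → extend-resp (dWord w) p≋q)
  ; ⊕-hom = λ p q → ≋-trans (extend-cong ψ (λ w → extend-⊕ (dWord w) p q))
                            (extend-⊕ᶠ (λ w → extend (dWord w) p) (λ w → extend (dWord w) q) ψ)
  ; ·-hom = λ a p → ≋-trans (extend-cong ψ (λ w → extend-· (dWord w) a p))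
                            (extend-·ᶠ a (λ w → extend (dWord w) p) ψ)
  }) (λ p → ≋-sym (∂≋extend ψ p))

∂-linearˡ : ∀ p → IsLinear (λ ψ → ∂ ψ p)
∂-linearˡ p = linear-resp-≋ (extend-linear (λ w → extend (dWord w) p)) (λ ψ → ≋-sym (∂≋extend ψ p))

∂-word : ∀ ψ x → ∂ ψ (word x) ≋ extend (λ w → dWord w x) ψ
∂-word ψ x = ≋-trans (∂≋extend ψ (word x)) (extend-cong ψ (λ w → extend-word (dWord w) x))

∂-word-word : ∀ w x → ∂ (word w) (word x) ≋ dWord w x
∂-word-word w x = ≋-trans (∂-word (word w) x) (extend-word (λ w → dWord w x) w)

∂-leibniz : ∀ ψ P Q → ∂ ψ (P ⊛ Q) ≋ ∂ ψ P ⊛ Q ⊕ P ⊛ ∂ ψ Q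
∂-leibniz ψ P Q =
  linear-ext (∘-linear (∂-linearʳ ψ) (⊛ˡ-linear Q))
             (⊕-linear (∘-linear (⊛ˡ-linear Q) (∂-linearʳ ψ)) (⊛ˡ-linear (∂ ψ Q)))
             (λ u → linear-ext (∘-linear (∂-linearʳ ψ) (⊛ʳ-linear (word u)))
                               (⊕-linear (⊛ʳ-linear (∂ ψ (word u))) (∘-linear (⊛ʳ-linear (word u)) (∂-linearʳ ψ)))
                               (on-words u) Q)
             P
  where
  on-words : ∀ u v → ∂ ψ (word u ⊛ word v) ≋ ∂ ψ (word u) ⊛ word v ⊕ word u ⊛ ∂ ψ (word v)
  on-words u v = begin
    ∂ ψ (word u ⊛ word v)
      ≈⟨ ≋-trans (≋-resp (∂-linearʳ ψ) (word-⊛-word u v)) (∂-word ψ (u ++ v)) ⟩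
    extend (λ w → dWord w (u ++ v)) ψ
      ≈⟨ extend-cong ψ (λ w → dWord-++ w u v) ⟩
    extend (λ w → dWord w u ⊛ word v ⊕ word u ⊛ dWord w v) ψ
      ≈⟨ extend-⊕ᶠ (λ w → dWord w u ⊛ word v) (λ w → word u ⊛ dWord w v) ψ ⟩
    extend (λ w → dWord w u ⊛ word v) ψ ⊕ extend (λ w → word u ⊛ dWord w v) ψ
      ≈⟨ ⊕-cong (linear-extend (⊛ˡ-linear (word v)) (λ w → dWord w u) ψ)
                (linear-extend (⊛ʳ-linear (word u)) (λ w → dWord w v) ψ) ⟨
    extend (λ w → dWord w u) ψ ⊛ word v ⊕ word u ⊛ extend (λ w → dWord w v) ψ
      ≈⟨ ⊕-cong (⊛-congˡ (word v) (∂-word ψ u)) (⊛-congʳ (word u) (∂-word ψ v)) ⟨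
    ∂ ψ (word u) ⊛ word v ⊕ word u ⊛ ∂ ψ (word v) ∎

∂-⟦⟧ : ∀ ψ X Y → ∂ ψ ⟦ X , Y ⟧ ≋ ⟦ ∂ ψ X , Y ⟧ ⊕ ⟦ X , ∂ ψ Y ⟧
∂-⟦⟧ ψ X Y = begin
  ∂ ψ (X ⊛ Y ⊕ neg (Y ⊛ X))
    ≈⟨ ⊕-hom L (X ⊛ Y) (neg (Y ⊛ X)) ⟩
  ∂ ψ (X ⊛ Y) ⊕ ∂ ψ (neg (Y ⊛ X))
    ≈⟨ ⊕-cong (∂-leibniz ψ X Y) (≋-trans (·-hom L (- 1ℚ) (Y ⊛ X)) (neg-cong (∂-leibniz ψ Y X))) ⟩
  (∂ ψ X ⊛ Y ⊕ X ⊛ ∂ ψ Y) ⊕ neg (∂ ψ Y ⊛ X ⊕ Y ⊛ ∂ ψ X)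
    ≈⟨ ≋-solve 4 (λ a b c d → (a ⊞ b) ⊞ ⊟ (c ⊞ d) ⊜ (a ⊞ ⊟ d) ⊞ (b ⊞ ⊟ c)) (λ _ → refl)
         (∂ ψ X ⊛ Y) (X ⊛ ∂ ψ Y) (∂ ψ Y ⊛ X) (Y ⊛ ∂ ψ X) ⟩
  ⟦ ∂ ψ X , Y ⟧ ⊕ ⟦ X , ∂ ψ Y ⟧ ∎
  where L = ∂-linearʳ ψ

record IsDerivation (D : Poly → Poly) : Set where
  field
    linear  : IsLinear D
    leibniz : ∀ P Q → D (P ⊛ Q) ≋ D P ⊛ Q ⊕ P ⊛ D Q
open IsDerivation public

∂-derivation : ∀ ψ → IsDerivation (∂ ψ)
∂-derivation ψ = record { linear = ∂-linearʳ ψ ; leibniz = ∂-leibniz ψ }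

derivation-word[] : ∀ {D} → IsDerivation D → D (word []) ≋ []
derivation-word[] {D} isD = self≋double⇒≋[] (begin
  D (word [])
    ≈⟨ ≋-resp (linear isD) (word-⊛-word [] []) ⟨
  D (word [] ⊛ word [])
    ≈⟨ leibniz isD (word []) (word []) ⟩
  D (word []) ⊛ word [] ⊕ word [] ⊛ D (word [])
    ≈⟨ ⊕-cong (⊛-word[] (D (word []))) (word[]-⊛ (D (word []))) ⟩
  D (word []) ⊕ D (word []) ∎)
  where
  self≋double⇒≋[] : ∀ {X} → X ≋ X ⊕ X → X ≋ []
  self≋double⇒≋[] {X} X≋2X = begin
    X                  ≈⟨ ≋-solve 1 (λ x → x ⊜ (x ⊞ x) ⊞ ⊟ x) (λ _ → refl) X ⟩
    (X ⊕ X) ⊕ neg X    ≈⟨ ⊕-cong X≋2X ≋-refl ⟨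
    X ⊕ neg X          ≈⟨ ≋-solve 1 (λ x → x ⊞ ⊟ x ⊜ ∅) (λ _ → refl) X ⟩
    []                 ∎

derivation-ext : ∀ {D E} → IsDerivation D → IsDerivation E →
                 (∀ a → D (gen a) ≋ E (gen a)) → ∀ p → D p ≋ E p
derivation-ext {D} {E} isD isE D≋E = linear-ext (linear isD) (linear isE) on-words
  where
  on-words : ∀ u → D (word u) ≋ E (word u)
  on-words [] = ≋-trans (derivation-word[] isD) (≋-sym (derivation-word[] isE))
  on-words (a ∷ u) = begin
    D (word (a ∷ u))
      ≈⟨ ≋-resp (linear isD) (word-⊛-word (a ∷ []) u) ⟨
    D (gen a ⊛ word u)
      ≈⟨ leibniz isD (gen a) (word u) ⟩
    D (gen a) ⊛ word u ⊕ gen a ⊛ D (word u)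
      ≈⟨ ⊕-cong (⊛-congˡ (word u) (D≋E a)) (⊛-congʳ (gen a) (on-words u)) ⟩
    E (gen a) ⊛ word u ⊕ gen a ⊛ E (word u)
      ≈⟨ leibniz isE (gen a) (word u) ⟨
    E (gen a ⊛ word u)
      ≈⟨ ≋-resp (linear isE) (word-⊛-word (a ∷ []) u) ⟩
    E (word (a ∷ u)) ∎

commutator-derivation : ∀ {D E} → IsDerivation D → IsDerivation E →
                        IsDerivation (λ p → D (E p) ⊕ neg (E (D p)))
commutator-derivation {D} {E} isD isE = record
  { linear = ⊕-linear (∘-linear (linear isD) (linear isE)) (neg-linear (∘-linear (linear isE) (linear isD)))
  ; leibniz = commutator-leibniz
  }
  where
  composite-leibniz : ∀ {D E} → IsDerivation D → IsDerivation E → ∀ P Q →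
    D (E (P ⊛ Q)) ≋ (D (E P) ⊛ Q ⊕ E P ⊛ D Q) ⊕ (D P ⊛ E Q ⊕ P ⊛ D (E Q))
  composite-leibniz {D} {E} isD isE P Q =
    ≋-trans (≋-resp (linear isD) (leibniz isE P Q))
            (≋-trans (⊕-hom (linear isD) (E P ⊛ Q) (P ⊛ E Q))
                     (⊕-cong (leibniz isD (E P) Q) (leibniz isD P (E Q))))

  -- The mixed terms E P ⊛ D Q and D P ⊛ E Q cancel.
  commutator-leibniz : ∀ P Q → D (E (P ⊛ Q)) ⊕ neg (E (D (P ⊛ Q))) ≋
                       (D (E P) ⊕ neg (E (D P))) ⊛ Q ⊕ P ⊛ (D (E Q) ⊕ neg (E (D Q)))
  commutator-leibniz P Q = begin
    D (E (P ⊛ Q)) ⊕ neg (E (D (P ⊛ Q)))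
      ≈⟨ ⊕-cong (composite-leibniz isD isE P Q) (neg-cong (composite-leibniz isE isD P Q)) ⟩
    ((D (E P) ⊛ Q ⊕ E P ⊛ D Q) ⊕ (D P ⊛ E Q ⊕ P ⊛ D (E Q))) ⊕
      neg ((E (D P) ⊛ Q ⊕ D P ⊛ E Q) ⊕ (E P ⊛ D Q ⊕ P ⊛ E (D Q)))
      ≈⟨ ≋-solve 6 (λ a b c d e f → ((a ⊞ b) ⊞ (c ⊞ d)) ⊞ ⊟ ((e ⊞ c) ⊞ (b ⊞ f))
                                  ⊜ (a ⊞ ⊟ e) ⊞ (d ⊞ ⊟ f))
           (λ _ → refl) (D (E P) ⊛ Q) (E P ⊛ D Q) (D P ⊛ E Q) (P ⊛ D (E Q)) (E (D P) ⊛ Q) (P ⊛ E (D Q)) ⟩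
    (D (E P) ⊛ Q ⊕ neg (E (D P) ⊛ Q)) ⊕ (P ⊛ D (E Q) ⊕ neg (P ⊛ E (D Q)))
      ≈⟨ ⊕-cong (≋-trans (⊛-distribʳ (D (E P)) (neg (E (D P))) Q) (⊕-cong ≋-refl (⊛-negˡ (E (D P)) Q)))
                (≋-trans (⊛-distribˡ P (D (E Q)) (neg (E (D Q)))) (⊕-cong ≋-refl (⊛-negʳ P (E (D Q))))) ⟨
    (D (E P) ⊕ neg (E (D P))) ⊛ Q ⊕ P ⊛ (D (E Q) ⊕ neg (E (D Q))) ∎

-- Finite differences and binomial sums

ℕtoℚ-+ : ∀ m n → ℕtoℚ (m +ₙ n) ≡ ℕtoℚ m + ℕtoℚ n
ℕtoℚ-+ m n = ℚ.toℚᵘ-injective (ℚᵘ.≃-trans (ℚᵘ.≃-reflexive (cong toℚᵘ (ℕtoℚ≡mkℚ (m +ₙ n))))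
  (ℚᵘ.≃-trans sum≃ (ℚᵘ.≃-sym (ℚᵘ.≃-trans (ℚ.toℚᵘ-homo-+ (ℕtoℚ m) (ℕtoℚ n))
    (ℚᵘ.≃-reflexive (cong₂ ℚᵘ._+_ (cong toℚᵘ (ℕtoℚ≡mkℚ m)) (cong toℚᵘ (ℕtoℚ≡mkℚ n))))))))
  where
  ℕtoℚ≡mkℚ : ∀ n → ℕtoℚ n ≡ mkℚ (ℤ.+ n) 0 (Coprime.sym (Coprime.1-coprimeTo n))
  ℕtoℚ≡mkℚ n = ℚ.normalize-coprime (Coprime.sym (Coprime.1-coprimeTo n))
  sum≃ : ℚᵘ.mkℚᵘ (ℤ.+ (m +ₙ n)) 0 ℚᵘ.≃ (ℚᵘ.mkℚᵘ (ℤ.+ m) 0 ℚᵘ.+ ℚᵘ.mkℚᵘ (ℤ.+ n) 0)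
  sum≃ = ℚᵘ.*≡* (trans (ℤ.*-identityʳ _) (sym (trans (ℤ.*-identityʳ _)
    (cong₂ ℤ._+_ (ℤ.*-identityʳ (ℤ.+ m)) (ℤ.*-identityʳ (ℤ.+ n))))))

signedBinom : ℕ → ℕ → ℚ
signedBinom k l = sgn (k ∸ l) * ℕtoℚ (k C l)

pascal : ℕ → ℕ → ℚ
pascal zero l = 1ℚ
pascal (suc a) zero = - pascal a zero
pascal (suc a) (suc l) = - pascal a (suc l) + pascal (suc a) l

pascal-closed : ∀ a l → pascal a l ≡ sgn a * ℕtoℚ ((a +ₙ l) C l)
pascal-closed zero l = sym (trans (ℚ.*-identityˡ _) (cong ℕtoℚ (nCn≡1 l)))
pascal-closed (suc a) zero = trans (cong -_ (pascal-closed a zero))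
  (solve 1 (λ x → :- (x :* con 1ℚ) := (:- x) :* con 1ℚ) refl (sgn a))
  where open ℚ-Solver
pascal-closed (suc a) (suc l) =
  trans (cong₂ (λ x y → - x + y) (pascal-closed a (suc l)) (pascal-closed (suc a) l))
  (trans (solve 3 (λ s x y → :- (s :* y) :+ (:- s) :* x := (:- s) :* (x :+ y)) refl
            (sgn a) (ℕtoℚ ((suc a +ₙ l) C l)) (ℕtoℚ ((a +ₙ suc l) C suc l)))
         (cong ((- sgn a) *_) (trans (sym (ℕtoℚ-+ ((suc a +ₙ l) C l) ((a +ₙ suc l) C suc l)))
                                     (cong ℕtoℚ pascal-rule))))
  where
  open ℚ-Solver
  pascal-rule : (suc a +ₙ l) C l +ₙ (a +ₙ suc l) C suc l ≡ (suc a +ₙ suc l) C suc l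
  pascal-rule rewrite ℕ.+-suc a l = nCk+nC[k+1]≡[n+1]C[k+1] (suc (a +ₙ l)) l

Σ< : ℕ → (ℕ → Poly) → Poly
Σ< zero f = []
Σ< (suc n) f = f 0 ⊕ Σ< n (f ∘ suc)

concatMap-applyUpTo : ∀ (f : ℕ → Poly) g n → concatMap f (applyUpTo g n) ≡ Σ< n (f ∘ g)
concatMap-applyUpTo f g zero = refl
concatMap-applyUpTo f g (suc n) = cong (f (g 0) ++_) (concatMap-applyUpTo f (g ∘ suc) n)

Σ<-cong : ∀ n {f g} → (∀ l → l ℕ.< n → f l ≋ g l) → Σ< n f ≋ Σ< n g
Σ<-cong zero f≋g = ≋-refl
Σ<-cong (suc n) f≋g = ⊕-cong (f≋g 0 (ℕ.s≤s ℕ.z≤n)) (Σ<-cong n (λ l l<n → f≋g (suc l) (ℕ.s≤s l<n)))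

Σ<-linear : ∀ {F} → IsLinear F → ∀ n f → F (Σ< n f) ≋ Σ< n (F ∘ f)
Σ<-linear L zero f = []-hom L
Σ<-linear L (suc n) f = ≋-trans (⊕-hom L (f 0) _) (⊕-cong ≋-refl (Σ<-linear L n (f ∘ suc)))

Σ<-⊕ : ∀ n f g → Σ< n (λ l → f l ⊕ g l) ≋ Σ< n f ⊕ Σ< n g
Σ<-⊕ zero f g = ≋-refl
Σ<-⊕ (suc n) f g = ≋-trans (⊕-cong ≋-refl (Σ<-⊕ n (f ∘ suc) (g ∘ suc)))
                           (⊕-interchange (f 0) (g 0) (Σ< n (f ∘ suc)) (Σ< n (g ∘ suc)))

Σ<-suc-last : ∀ n f → Σ< (suc n) f ≋ Σ< n f ⊕ f n
Σ<-suc-last zero f = ≡⇒≋ (⊕-identityʳ (f 0))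
Σ<-suc-last (suc n) f = ≋-trans (⊕-congʳ (f 0) (Σ<-suc-last n (f ∘ suc)))
  (≋-solve 3 (λ x y z → x ⊞ (y ⊞ z) ⊜ (x ⊞ y) ⊞ z) (λ _ → refl) (f 0) (Σ< n (f ∘ suc)) (f (suc n)))

Σ<-concatMap : ∀ {A : Set} n (f : ℕ → A → Poly) xs →
  Σ< n (λ l → concatMap (f l) xs) ≋ concatMap (λ x → Σ< n (λ l → f l x)) xs
Σ<-concatMap zero f xs = ≡⇒≋ (sym (concatMap-[] xs))
Σ<-concatMap (suc n) f xs = ≋-trans (⊕-cong ≋-refl (Σ<-concatMap n (f ∘ suc) xs))
  (≋-sym (concatMap-⊕ (f 0) (λ x → Σ< n (λ l → f (suc l) x)) xs))

Σanti : ℕ → (ℕ → ℕ → Poly) → Poly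
Σanti k F = Σ< (suc k) (λ l → F (k ∸ l) l)

Σanti-suc-last : ∀ k F → Σanti (suc k) F ≋ Σanti k (λ a l → F (suc a) l) ⊕ F 0 (suc k)
Σanti-suc-last k F = ≋-trans (Σ<-suc-last (suc k) (λ l → F (suc k ∸ l) l))
  (⊕-cong (Σ<-cong (suc k) (λ l l≤k → ≡⇒≋ (cong (λ a → F a l) (ℕ.+-∸-assoc 1 (ℕ.≤-pred l≤k)))))
          (≡⇒≋ (cong (λ a → F a (suc k)) (ℕ.n∸n≡0 k))))

Σanti-cong : ∀ k {F G} → (∀ a l → F a l ≋ G a l) → Σanti k F ≋ Σanti k G
Σanti-cong k F≋G = Σ<-cong (suc k) (λ l _ → F≋G (k ∸ l) l)

Σpascal : ℕ → (ℕ → ℕ → Poly) → Poly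
Σpascal k H = Σanti k (λ a l → pascal a l · H a l)

Σpascal-suc : ∀ k H → Σpascal (suc k) H ≋ Σpascal k (λ a l → H a (suc l)) ⊕ neg (Σpascal k (λ a l → H (suc a) l))
Σpascal-suc k H = begin
  pascal (suc k) 0 · H (suc k) 0 ⊕ Σanti k (λ a l → pascal a (suc l) · H a (suc l))
    ≈⟨ ⊕-congʳ (pascal (suc k) 0 · H (suc k) 0) (≋-trans (Σanti-cong k pascal-split)
                               (Σ<-⊕ (suc k) (λ l → pascal (k ∸ l) l · H (k ∸ l) (suc l)) (λ l → W (k ∸ l) l))) ⟩
  pascal (suc k) 0 · H (suc k) 0 ⊕ (Σpascal k (λ a l → H a (suc l)) ⊕ Σanti k W)
    ≈⟨ boundary k ⟩
  Σpascal k (λ a l → H a (suc l)) ⊕ neg (Σpascal k (λ a l → H (suc a) l)) ∎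
  where
  W : ℕ → ℕ → Poly
  W zero l = []
  W (suc a) l = neg (pascal a (suc l) · H (suc a) (suc l))
  pascal-split : ∀ a l → pascal a (suc l) · H a (suc l) ≋ pascal a l · H a (suc l) ⊕ W a l
  pascal-split zero l = ≡⇒≋ (sym (⊕-identityʳ _))
  pascal-split (suc a) l = begin
    (- pascal a (suc l) + pascal (suc a) l) · X
      ≈⟨ ·-distribʳ (- pascal a (suc l)) (pascal (suc a) l) X ⟩
    (- pascal a (suc l)) · X ⊕ pascal (suc a) l · X
      ≈⟨ ⊕-cong (-‿· (pascal a (suc l)) X) ≋-refl ⟩
    neg (pascal a (suc l) · X) ⊕ pascal (suc a) l · X
      ≈⟨ ≋-solve 2 (λ x y → x ⊞ y ⊜ y ⊞ x) (λ _ → refl) (neg (pascal a (suc l) · X)) (pascal (suc a) l · X) ⟩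
    pascal (suc a) l · X ⊕ W (suc a) l ∎
    where X = H (suc a) (suc l)
  boundary : ∀ k → pascal (suc k) 0 · H (suc k) 0 ⊕ (Σpascal k (λ a l → H a (suc l)) ⊕ Σanti k W)
                   ≋ Σpascal k (λ a l → H a (suc l)) ⊕ neg (Σpascal k (λ a l → H (suc a) l))
  boundary zero = ≋-solve 2 (λ x y → (- 1ℚ) ⊡ x ⊞ (y ⊞ (∅ ⊞ ∅)) ⊜ y ⊞ ⊟ ((1ℚ ⊡ x) ⊞ ∅)) (λ _ → refl)
                    (H 1 0) (Σpascal 0 (λ a l → H a (suc l)))
  boundary (suc k) = begin
    pascal (suc (suc k)) 0 · H (suc (suc k)) 0 ⊕ (S ⊕ Σanti (suc k) W)
      ≈⟨ ⊕-cong (-‿· (pascal (suc k) 0) (H (suc (suc k)) 0))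
                (⊕-congʳ S (≋-trans (Σanti-suc-last k W)
                  (⊕-congˡ [] (≋-sym (Σ<-linear (neg-linear id-linear) (suc k) (λ l → V (k ∸ l) l)))))) ⟩
    neg U ⊕ (S ⊕ (neg (Σanti k V) ⊕ []))
      ≈⟨ ≋-solve 3 (λ u s v → ⊟ u ⊞ (s ⊞ (⊟ v ⊞ ∅)) ⊜ s ⊞ ⊟ (u ⊞ v)) (λ _ → refl) U S (Σanti k V) ⟩
    S ⊕ neg (U ⊕ Σanti k V) ∎
    where
    S = Σpascal (suc k) (λ a l → H a (suc l))
    U = pascal (suc k) 0 · H (suc (suc k)) 0
    V = λ a l → pascal a (suc l) · H (suc a) (suc l)

-- Δ k H = ((E₂ − E₁)ᵏ H) 0 0 for the shifts E₁, E₂ in the two arguments of H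
-- (Δ-suc); it is the binomial sum in the definition of ∂.
Δ : ℕ → (ℕ → ℕ → Poly) → Poly
Δ k H = Σ< (suc k) (λ l → signedBinom k l · H (k ∸ l) l)

Δ≋Σpascal : ∀ k H → Δ k H ≋ Σpascal k H
Δ≋Σpascal k H = Σ<-cong (suc k) (λ l l≤k → ≡⇒≋ (cong (_· H (k ∸ l) l)
  (trans (cong (λ n → sgn (k ∸ l) * ℕtoℚ (n C l)) (sym (ℕ.m∸n+n≡m (ℕ.≤-pred l≤k))))
         (sym (pascal-closed (k ∸ l) l)))))

Δ-suc : ∀ k H → Δ (suc k) H ≋ Δ k (λ a l → H a (suc l)) ⊕ neg (Δ k (λ a l → H (suc a) l))
Δ-suc k H = ≋-trans (Δ≋Σpascal (suc k) H) (≋-trans (Σpascal-suc k H)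
  (≋-sym (⊕-cong (Δ≋Σpascal k (λ a l → H a (suc l))) (neg-cong (Δ≋Σpascal k (λ a l → H (suc a) l))))))

Δ-zero : ∀ H → Δ 0 H ≋ H 0 0
Δ-zero H = ≋-trans (≡⇒≋ (⊕-identityʳ _)) (·-identityˡ (H 0 0))

Δ-cong : ∀ k {H H′} → (∀ a l → H a l ≋ H′ a l) → Δ k H ≋ Δ k H′
Δ-cong k H≋H′ = Σ<-cong (suc k) (λ l _ → ·-cong (signedBinom k l) (H≋H′ (k ∸ l) l))

Δ-linear : ∀ {F} → IsLinear F → ∀ k H → F (Δ k H) ≋ Δ k (λ a l → F (H a l))
Δ-linear L k H = ≋-trans (Σ<-linear L (suc k) (λ l → signedBinom k l · H (k ∸ l) l))
                         (Σ<-cong (suc k) (λ l _ → ·-hom L (signedBinom k l) (H (k ∸ l) l)))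

Δ-⊕ : ∀ k H H′ → Δ k (λ a l → H a l ⊕ H′ a l) ≋ Δ k H ⊕ Δ k H′
Δ-⊕ k H H′ = ≋-trans (Σ<-cong (suc k) (λ l _ → ≡⇒≋ (·-⊕ (signedBinom k l) (H (k ∸ l) l) (H′ (k ∸ l) l))))
  (Σ<-⊕ (suc k) (λ l → signedBinom k l · H (k ∸ l) l) (λ l → signedBinom k l · H′ (k ∸ l) l))

Δ-⊖ : ∀ k H H′ → Δ k (λ a l → H a l ⊕ neg (H′ a l)) ≋ Δ k H ⊕ neg (Δ k H′)
Δ-⊖ k H H′ = ≋-trans (Δ-⊕ k H (λ a l → neg (H′ a l)))
                     (⊕-cong ≋-refl (≋-sym (Δ-linear (neg-linear id-linear) k H′)))

-- Σbinom n F = ((E₁ + E₂)ⁿ F) 0 0, with E₁, E₂ as for Δ.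
Σbinom : ℕ → (ℕ → ℕ → Poly) → Poly
Σbinom zero F = F 0 0
Σbinom (suc n) F = Σbinom n (λ t s → F (suc t) s) ⊕ Σbinom n (λ t s → F t (suc s))

Σbinom-cong : ∀ n {F G} → (∀ t s → F t s ≋ G t s) → Σbinom n F ≋ Σbinom n G
Σbinom-cong zero F≋G = F≋G 0 0
Σbinom-cong (suc n) F≋G = ⊕-cong (Σbinom-cong n (λ t s → F≋G (suc t) s)) (Σbinom-cong n (λ t s → F≋G t (suc s)))

Σbinom-linear : ∀ {F} → IsLinear F → ∀ n G → F (Σbinom n G) ≋ Σbinom n (λ t s → F (G t s))
Σbinom-linear L zero G = ≋-refl
Σbinom-linear L (suc n) G = ≋-trans (⊕-hom L _ _) (⊕-cong (Σbinom-linear L n _) (Σbinom-linear L n _))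

Σbinom-⊕ : ∀ n F G → Σbinom n (λ t s → F t s ⊕ G t s) ≋ Σbinom n F ⊕ Σbinom n G
Σbinom-⊕ zero F G = ≋-refl
Σbinom-⊕ (suc n) F G = ≋-trans (⊕-cong (Σbinom-⊕ n _ _) (Σbinom-⊕ n _ _))
  (⊕-interchange (Σbinom n (λ t s → F (suc t) s)) (Σbinom n (λ t s → G (suc t) s))
                 (Σbinom n (λ t s → F t (suc s))) (Σbinom n (λ t s → G t (suc s))))

-- Both sides are ((E₃ − E₁ − E₂)ᵏ H) 0 0 0, for the shifts Eᵢ in the arguments of H.
Δ-Δ : ∀ k H → Δ k (λ a l → Δ l (H a)) ≋ Δ k (λ d m → Σbinom d (λ t s → H t s m))
Δ-Δ zero H = ≋-trans (Δ-zero (λ a l → Δ l (H a))) (≋-trans (Δ-zero (H 0))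
  (≋-sym (Δ-zero (λ d m → Σbinom d (λ t s → H t s m)))))
Δ-Δ (suc k) H = begin
  Δ (suc k) (λ a l → Δ l (H a))
    ≈⟨ Δ-suc k (λ a l → Δ l (H a)) ⟩
  Δ k (λ a l → Δ (suc l) (H a)) ⊕ neg (ΔΔ k H₃)
    ≈⟨ ⊕-congˡ (neg (ΔΔ k H₃)) (≋-trans (Δ-cong k (λ a l → Δ-suc l (H a)))
         (Δ-⊖ k (λ a l → Δ l (H₁ a)) (λ a l → Δ l (H₂ a)))) ⟩
  (ΔΔ k H₁ ⊕ neg (ΔΔ k H₂)) ⊕ neg (ΔΔ k H₃)
    ≈⟨ ⊕-cong (⊕-cong (Δ-Δ k H₁) (neg-cong (Δ-Δ k H₂))) (neg-cong (Δ-Δ k H₃)) ⟩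
  (ΔΣ k H₁ ⊕ neg (ΔΣ k H₂)) ⊕ neg (ΔΣ k H₃)
    ≈⟨ ≋-solve 3 (λ x y z → (x ⊞ ⊟ y) ⊞ ⊟ z ⊜ x ⊞ ⊟ (z ⊞ y)) (λ _ → refl) (ΔΣ k H₁) (ΔΣ k H₂) (ΔΣ k H₃) ⟩
  ΔΣ k H₁ ⊕ neg (ΔΣ k H₃ ⊕ ΔΣ k H₂)
    ≈⟨ ⊕-congʳ (ΔΣ k H₁) (neg-cong (Δ-⊕ k (λ d m → Σbinom d (λ t s → H₃ t s m))
                                            (λ d m → Σbinom d (λ t s → H₂ t s m)))) ⟨
  ΔΣ k H₁ ⊕ neg (Δ k (λ d m → Σbinom (suc d) (λ t s → H t s m)))
    ≈⟨ Δ-suc k (λ d m → Σbinom d (λ t s → H t s m)) ⟨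
  Δ (suc k) (λ d m → Σbinom d (λ t s → H t s m)) ∎
  where
  ΔΔ ΔΣ : ℕ → (ℕ → ℕ → ℕ → Poly) → Poly
  ΔΔ k H = Δ k (λ a l → Δ l (H a))
  ΔΣ k H = Δ k (λ d m → Σbinom d (λ t s → H t s m))
  H₁ H₂ H₃ : ℕ → ℕ → ℕ → Poly
  H₁ a b m = H a b (suc m)
  H₂ a b m = H a (suc b) m
  H₃ a b m = H (suc a) b m

Σbinom-Δ-Δ : ∀ n k (H : ℕ → ℕ → ℕ → Poly) →
  Σbinom n (λ s s′ → Δ k (λ a l → Δ l (λ b m → H (a +ₙ s) (b +ₙ s′) m)))
    ≋ Δ k (λ d m → Σbinom (d +ₙ n) (λ t s′ → H t s′ m))
Σbinom-Δ-Δ zero k H = begin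
  Δ k (λ a l → Δ l (λ b m → H (a +ₙ 0) (b +ₙ 0) m))
    ≈⟨ Δ-cong k (λ a l → Δ-cong l (λ b m → ≡⇒≋ (cong₂ (λ x y → H x y m) (ℕ.+-identityʳ a) (ℕ.+-identityʳ b)))) ⟩
  Δ k (λ a l → Δ l (H a))
    ≈⟨ Δ-Δ k H ⟩
  Δ k (λ d m → Σbinom d (λ t s′ → H t s′ m))
    ≈⟨ Δ-cong k (λ d m → ≡⇒≋ (cong (λ n → Σbinom n (λ t s′ → H t s′ m)) (ℕ.+-identityʳ d))) ⟨
  Δ k (λ d m → Σbinom (d +ₙ 0) (λ t s′ → H t s′ m)) ∎
Σbinom-Δ-Δ (suc n) k H = begin
  Σbinom n (λ s s′ → Δ k (λ a l → Δ l (λ b m → H (a +ₙ suc s) (b +ₙ s′) m)))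
    ⊕ Σbinom n (λ s s′ → Δ k (λ a l → Δ l (λ b m → H (a +ₙ s) (b +ₙ suc s′) m)))
    ≈⟨ ⊕-cong (Σbinom-cong n (λ s s′ → Δ-cong k (λ a l → Δ-cong l (λ b m →
                 ≡⇒≋ (cong (λ x → H x (b +ₙ s′) m) (ℕ.+-suc a s))))))
              (Σbinom-cong n (λ s s′ → Δ-cong k (λ a l → Δ-cong l (λ b m →
                 ≡⇒≋ (cong (λ y → H (a +ₙ s) y m) (ℕ.+-suc b s′)))))) ⟩
  Σbinom n (λ s s′ → Δ k (λ a l → Δ l (λ b m → H (suc (a +ₙ s)) (b +ₙ s′) m)))
    ⊕ Σbinom n (λ s s′ → Δ k (λ a l → Δ l (λ b m → H (a +ₙ s) (suc (b +ₙ s′)) m)))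
    ≈⟨ ⊕-cong (Σbinom-Δ-Δ n k (λ t s m → H (suc t) s m)) (Σbinom-Δ-Δ n k (λ t s m → H t (suc s) m)) ⟩
  Δ k (λ d m → Σbinom (d +ₙ n) (λ t s′ → H (suc t) s′ m))
    ⊕ Δ k (λ d m → Σbinom (d +ₙ n) (λ t s′ → H t (suc s′) m))
    ≈⟨ Δ-⊕ k (λ d m → Σbinom (d +ₙ n) (λ t s′ → H (suc t) s′ m))
             (λ d m → Σbinom (d +ₙ n) (λ t s′ → H t (suc s′) m)) ⟨
  Δ k (λ d m → Σbinom (suc (d +ₙ n)) (λ t s′ → H t s′ m))
    ≈⟨ Δ-cong k (λ d m → ≡⇒≋ (cong (λ x → Σbinom x (λ t s′ → H t s′ m)) (ℕ.+-suc d n))) ⟨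
  Δ k (λ d m → Σbinom (d +ₙ suc n) (λ t s′ → H t s′ m)) ∎

-- In operator form Σₜ binom(n,t) (E₂ − E₁)^(k+t) E₁^(n−t) = (E₂ − E₁)ᵏ E₂ⁿ, by the
-- binomial theorem.
Σbinom-Δ : ∀ n k (J : ℕ → ℕ → Poly) →
  Σbinom n (λ t s′ → Δ (k +ₙ t) (λ a l → J (a +ₙ s′) l)) ≋ Δ k (λ a l → J a (l +ₙ n))
Σbinom-Δ zero k J = ≋-trans (≡⇒≋ (cong (λ x → Δ x (λ a l → J (a +ₙ 0) l)) (ℕ.+-identityʳ k)))
  (Δ-cong k (λ a l → ≡⇒≋ (cong₂ J (ℕ.+-identityʳ a) (sym (ℕ.+-identityʳ l)))))
Σbinom-Δ (suc n) k J = begin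
  Σbinom n (λ t s → Δ (k +ₙ suc t) (λ a l → J (a +ₙ s) l))
    ⊕ Σbinom n (λ t s → Δ (k +ₙ t) (λ a l → J (a +ₙ suc s) l))
    ≈⟨ ⊕-cong (Σbinom-cong n (λ t s → ≋-trans (≡⇒≋ (cong (λ x → Δ x (λ a l → J (a +ₙ s) l)) (ℕ.+-suc k t)))
                                                (Δ-suc (k +ₙ t) (λ a l → J (a +ₙ s) l))))
              (Σbinom-cong n (λ t s → Δ-cong (k +ₙ t) (λ a l → ≡⇒≋ (cong (λ x → J x l) (ℕ.+-suc a s))))) ⟩
  Σbinom n (λ t s → P t s ⊕ neg (Q t s)) ⊕ Σbinom n Q
    ≈⟨ ⊕-congˡ (Σbinom n Q) (≋-trans (Σbinom-⊕ n P (λ t s → neg (Q t s)))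
         (⊕-congʳ (Σbinom n P) (≋-sym (Σbinom-linear (neg-linear id-linear) n Q)))) ⟩
  (Σbinom n P ⊕ neg (Σbinom n Q)) ⊕ Σbinom n Q
    ≈⟨ ≋-solve 2 (λ p q → (p ⊞ ⊟ q) ⊞ q ⊜ p) (λ _ → refl) (Σbinom n P) (Σbinom n Q) ⟩
  Σbinom n P
    ≈⟨ Σbinom-Δ n k (λ a l → J a (suc l)) ⟩
  Δ k (λ a l → J a (suc (l +ₙ n)))
    ≈⟨ Δ-cong k (λ a l → ≡⇒≋ (cong (J a) (ℕ.+-suc l n))) ⟨
  Δ k (λ a l → J a (l +ₙ suc n)) ∎
  where
  P Q : ℕ → ℕ → Poly
  P t s = Δ (k +ₙ t) (λ a l → J (a +ₙ s) (suc l))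
  Q t s = Δ (k +ₙ t) (λ a l → J (suc (a +ₙ s)) l)

-- The binomial expansion in the definition of ∂

subsTerm : (ℕ → Word → Poly) → ℚ × ℕ × Word → Poly
subsTerm G (c , s , u) = c · G s u

Σsubs : Word → (ℕ → Word → Poly) → Poly
Σsubs w G = concatMap (subsTerm G) (subs w)

Σsubs-cong : ∀ w {G H} → (∀ s u → G s u ≋ H s u) → Σsubs w G ≋ Σsubs w H
Σsubs-cong w G≋H = concatMap-cong≋ (subs w) (λ { (c , s , u) → ·-cong c (G≋H s u) })

Σsubs-⊕ : ∀ w G H → Σsubs w (λ s u → G s u ⊕ H s u) ≋ Σsubs w G ⊕ Σsubs w H
Σsubs-⊕ w G H = ≋-trans (concatMap-cong≋ (subs w) (λ { (c , s , u) → ≡⇒≋ (·-⊕ c (G s u) (H s u)) }))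
                        (concatMap-⊕ (subsTerm G) (subsTerm H) (subs w))

Σsubs-linear : ∀ {F} → IsLinear F → ∀ w G → F (Σsubs w G) ≋ Σsubs w (λ s u → F (G s u))
Σsubs-linear L w G = ≋-trans (linear-concatMap L (subsTerm G) (subs w))
                             (concatMap-cong≋ (subs w) (λ { (c , s , u) → ·-hom L c (G s u) }))

Σsubs-⊖ : ∀ w G H → Σsubs w (λ s u → G s u ⊕ neg (H s u)) ≋ Σsubs w G ⊕ neg (Σsubs w H)
Σsubs-⊖ w G H = ≋-trans (Σsubs-⊕ w G (λ s u → neg (H s u)))
                        (⊕-congʳ (Σsubs w G) (≋-sym (Σsubs-linear (neg-linear id-linear) w H)))

Σsubs-[] : ∀ G → Σsubs [] G ≋ G 0 []
Σsubs-[] G = ≋-trans (≡⇒≋ (⊕-identityʳ _)) (·-identityˡ (G 0 []))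

Σsubs-b₀ : ∀ w G → Σsubs (zero ∷ w) G ≋ Σsubs w (λ s u → G s (zero ∷ u))
Σsubs-b₀ w G = ≡⇒≋ (concatMap-map (subsTerm G) _ (subs w))

Σsubs-b : ∀ k w G → Σsubs (suc k ∷ w) G ≋ Δ k (λ a l → Σsubs w (λ s u → G (a +ₙ s) (suc l ∷ u)))
Σsubs-b k w G = begin
  concatMap (subsTerm G) (concatMap (λ l → map (extendSub l) (subs w)) (upTo (suc k)))
    ≡⟨ trans (concatMap-concatMap (subsTerm G) (λ l → map (extendSub l) (subs w)) (upTo (suc k)))
             (concatMap-applyUpTo (λ l → concatMap (subsTerm G) (map (extendSub l) (subs w))) id (suc k)) ⟩
  Σ< (suc k) (λ l → concatMap (subsTerm G) (map (extendSub l) (subs w)))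
    ≈⟨ Σ<-cong (suc k) (λ l _ → begin
         concatMap (subsTerm G) (map (extendSub l) (subs w))
           ≡⟨ concatMap-map (subsTerm G) (extendSub l) (subs w) ⟩
         concatMap (λ { (c , s , u) → (signedBinom k l * c) · G ((k ∸ l) +ₙ s) (suc l ∷ u) }) (subs w)
           ≈⟨ concatMap-cong≋ (subs w) (λ { (c , s , u) → ·-assoc (signedBinom k l) c _ }) ⟨
         concatMap (λ { (c , s , u) → signedBinom k l · (c · G ((k ∸ l) +ₙ s) (suc l ∷ u)) }) (subs w)
           ≈⟨ concatMap-· (signedBinom k l) (subsTerm (λ s u → G ((k ∸ l) +ₙ s) (suc l ∷ u))) (subs w) ⟩
         signedBinom k l · Σsubs w (λ s u → G ((k ∸ l) +ₙ s) (suc l ∷ u)) ∎) ⟩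
  Δ k (λ a l → Σsubs w (λ s u → G (a +ₙ s) (suc l ∷ u))) ∎
  where
  extendSub : ℕ → ℚ × ℕ × Word → ℚ × ℕ × Word
  extendSub l (c , s , u) = (signedBinom k l * c , (k ∸ l) +ₙ s , suc l ∷ u)

Σsubs-comm : ∀ w w′ (G : ℕ → Word → ℕ → Word → Poly) →
  Σsubs w (λ s u → Σsubs w′ (G s u)) ≋ Σsubs w′ (λ s′ u′ → Σsubs w (λ s u → G s u s′ u′))
Σsubs-comm w w′ G = begin
  Σsubs w (λ s u → Σsubs w′ (G s u))
    ≈⟨ concatMap-cong≋ (subs w) (λ { (c , s , u) → Σsubs-linear (·-linear c id-linear) w′ (G s u) }) ⟩
  concatMap (λ { (c , s , u) → concatMap (λ { (c′ , s′ , u′) → c′ · (c · G s u s′ u′) }) (subs w′) }) (subs w)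
    ≈⟨ concatMap-cong≋ (subs w) (λ { (c , s , u) →
         concatMap-cong≋ (subs w′) (λ { (c′ , s′ , u′) → ·-comm c′ c _ }) }) ⟩
  concatMap (λ { (c , s , u) → concatMap (λ { (c′ , s′ , u′) → c · (c′ · G s u s′ u′) }) (subs w′) }) (subs w)
    ≈⟨ concatMap-comm (λ { (c , s , u) (c′ , s′ , u′) → c · (c′ · G s u s′ u′) }) (subs w) (subs w′) ⟩
  concatMap (λ { (c′ , s′ , u′) → concatMap (λ { (c , s , u) → c · (c′ · G s u s′ u′) }) (subs w) }) (subs w′)
    ≈⟨ concatMap-cong≋ (subs w′) (λ { (c′ , s′ , u′) →
         Σsubs-linear (·-linear c′ id-linear) w (λ s u → G s u s′ u′) }) ⟨
  Σsubs w′ (λ s′ u′ → Σsubs w (λ s u → G s u s′ u′)) ∎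

Δ-Σsubs : ∀ k w (G : ℕ → ℕ → ℕ → Word → Poly) →
  Δ k (λ a l → Σsubs w (G a l)) ≋ Σsubs w (λ s u → Δ k (λ a l → G a l s u))
Δ-Σsubs k w G = begin
  Δ k (λ a l → Σsubs w (G a l))
    ≈⟨ Σ<-cong (suc k) (λ l _ → Σsubs-linear (·-linear (signedBinom k l) id-linear) w (G (k ∸ l) l)) ⟩
  Σ< (suc k) (λ l → Σsubs w (λ s u → signedBinom k l · G (k ∸ l) l s u))
    ≈⟨ Σ<-concatMap (suc k) (λ l → subsTerm (λ s u → signedBinom k l · G (k ∸ l) l s u)) (subs w) ⟩
  concatMap (λ x → Σ< (suc k) (λ l → subsTerm (λ s u → signedBinom k l · G (k ∸ l) l s u) x)) (subs w)
    ≈⟨ concatMap-cong≋ (subs w) (λ { (c , s , u) →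
         Σ<-linear (·-linear c id-linear) (suc k) (λ l → signedBinom k l · G (k ∸ l) l s u) }) ⟨
  Σsubs w (λ s u → Δ k (λ a l → G a l s u)) ∎

Σsubs-++ : ∀ u v G → Σsubs (u ++ v) G ≋ Σsubs u (λ s u′ → Σsubs v (λ s′ v′ → G (s +ₙ s′) (u′ ++ v′)))
Σsubs-++ [] v G = ≋-sym (Σsubs-[] (λ s u′ → Σsubs v (λ s′ v′ → G (s +ₙ s′) (u′ ++ v′))))
Σsubs-++ (zero ∷ u) v G = ≋-trans (Σsubs-b₀ (u ++ v) G) (≋-trans (Σsubs-++ u v (λ s x → G s (zero ∷ x)))
  (≋-sym (Σsubs-b₀ u (λ s u′ → Σsubs v (λ s′ v′ → G (s +ₙ s′) (u′ ++ v′))))))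
Σsubs-++ (suc k ∷ u) v G = begin
  Σsubs (suc k ∷ u ++ v) G
    ≈⟨ Σsubs-b k (u ++ v) G ⟩
  Δ k (λ a l → Σsubs (u ++ v) (λ s x → G (a +ₙ s) (suc l ∷ x)))
    ≈⟨ Δ-cong k (λ a l → ≋-trans (Σsubs-++ u v (λ s x → G (a +ₙ s) (suc l ∷ x)))
         (Σsubs-cong u (λ s u′ → Σsubs-cong v (λ s′ v′ →
           ≡⇒≋ (cong (λ n → G n (suc l ∷ u′ ++ v′)) (sym (ℕ.+-assoc a s s′))))))) ⟩
  Δ k (λ a l → Σsubs u (λ s u′ → Σsubs v (λ s′ v′ → G ((a +ₙ s) +ₙ s′) (suc l ∷ u′ ++ v′))))
    ≈⟨ Σsubs-b k u (λ s u′ → Σsubs v (λ s′ v′ → G (s +ₙ s′) (u′ ++ v′))) ⟨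
  Σsubs (suc k ∷ u) (λ s u′ → Σsubs v (λ s′ v′ → G (s +ₙ s′) (u′ ++ v′))) ∎

-- Expanding a word twice is expanding it once and spreading the index shift
-- binomially over the two expansions.
Σsubs-Σsubs : ∀ w (G : ℕ → ℕ → Word → Poly) →
  Σsubs w (λ t v → Σsubs v (G t)) ≋ Σsubs w (λ n v′ → Σbinom n (λ t s′ → G t s′ v′))
Σsubs-Σsubs [] G = ≋-trans (Σsubs-[] (λ t v → Σsubs v (G t))) (≋-trans (Σsubs-[] (G 0))
  (≋-sym (Σsubs-[] (λ n v′ → Σbinom n (λ t s′ → G t s′ v′)))))
Σsubs-Σsubs (zero ∷ w) G = begin
  Σsubs (zero ∷ w) (λ t v → Σsubs v (G t))
    ≈⟨ ≋-trans (Σsubs-b₀ w (λ t v → Σsubs v (G t))) (Σsubs-cong w (λ t v → Σsubs-b₀ v (G t))) ⟩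
  Σsubs w (λ t v → Σsubs v (λ s′ v′ → G t s′ (zero ∷ v′)))
    ≈⟨ Σsubs-Σsubs w (λ t s′ v′ → G t s′ (zero ∷ v′)) ⟩
  Σsubs w (λ n v′ → Σbinom n (λ t s′ → G t s′ (zero ∷ v′)))
    ≈⟨ Σsubs-b₀ w (λ n v′ → Σbinom n (λ t s′ → G t s′ v′)) ⟨
  Σsubs (zero ∷ w) (λ n v′ → Σbinom n (λ t s′ → G t s′ v′)) ∎
Σsubs-Σsubs (suc k ∷ w) G = begin
  Σsubs (suc k ∷ w) (λ t v → Σsubs v (G t))
    ≈⟨ Σsubs-b k w (λ t v → Σsubs v (G t)) ⟩
  Δ k (λ a l → Σsubs w (λ s u → Σsubs (suc l ∷ u) (G (a +ₙ s))))
    ≈⟨ Δ-cong k (λ a l → Σsubs-cong w (λ s u → ≋-trans (Σsubs-b l u (G (a +ₙ s)))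
         (Δ-Σsubs l u (λ b m s′ u′ → G (a +ₙ s) (b +ₙ s′) (suc m ∷ u′))))) ⟩
  Δ k (λ a l → Σsubs w (λ s u → Σsubs u (λ s′ u′ → K s s′ u′ a l)))
    ≈⟨ ≋-trans (Δ-Σsubs k w (λ a l s u → Σsubs u (λ s′ u′ → K s s′ u′ a l)))
               (Σsubs-cong w (λ s u → Δ-Σsubs k u (λ a l s′ u′ → K s s′ u′ a l))) ⟩
  Σsubs w (λ s u → Σsubs u (λ s′ u′ → Δ k (K s s′ u′)))
    ≈⟨ Σsubs-Σsubs w (λ s s′ u′ → Δ k (K s s′ u′)) ⟩
  Σsubs w (λ n u′ → Σbinom n (λ s s′ → Δ k (K s s′ u′)))
    ≈⟨ Σsubs-cong w (λ n u′ → Σbinom-Δ-Δ n k (λ t s m → G t s (suc m ∷ u′))) ⟩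
  Σsubs w (λ n u′ → Δ k (λ d m → Σbinom (d +ₙ n) (λ t s′ → G t s′ (suc m ∷ u′))))
    ≈⟨ ≋-trans (Σsubs-b k w (λ n v′ → Σbinom n (λ t s′ → G t s′ v′)))
               (Δ-Σsubs k w (λ d m n u′ → Σbinom (d +ₙ n) (λ t s′ → G t s′ (suc m ∷ u′)))) ⟨
  Σsubs (suc k ∷ w) (λ n v′ → Σbinom n (λ t s′ → G t s′ v′)) ∎
  where
  K : ℕ → ℕ → Word → ℕ → ℕ → Poly
  K s s′ u′ a l = Δ l (λ b m → G (a +ₙ s) (b +ₙ s′) (suc m ∷ u′))

Σsubsₚ : Poly → (ℕ → Word → Poly) → Poly
Σsubsₚ p G = extend (λ w → Σsubs w G) p

extend-Σsubs : ∀ u (K : Word → ℕ → Word → Poly) Q →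
  extend (λ v → Σsubs u (K v)) Q ≋ Σsubs u (λ s u′ → extend (λ v → K v s u′) Q)
extend-Σsubs u K Q = begin
  extend (λ v → Σsubs u (K v)) Q
    ≈⟨ concatMap-cong≋ Q (λ { (c , v) → Σsubs-linear (·-linear c id-linear) u (K v) }) ⟩
  concatMap (λ { (c , v) → concatMap (λ { (d , s , u′) → d · (c · K v s u′) }) (subs u) }) Q
    ≈⟨ concatMap-cong≋ Q (λ { (c , v) → concatMap-cong≋ (subs u) (λ { (d , s , u′) → ·-comm d c _ }) }) ⟩
  concatMap (λ { (c , v) → concatMap (λ { (d , s , u′) → c · (d · K v s u′) }) (subs u) }) Q
    ≈⟨ concatMap-comm (λ { (c , v) (d , s , u′) → c · (d · K v s u′) }) Q (subs u) ⟩
  concatMap (λ { (d , s , u′) → concatMap (λ { (c , v) → c · (d · K v s u′) }) Q }) (subs u)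
    ≈⟨ concatMap-cong≋ (subs u) (λ { (d , s , u′) → extend-·ᶠ d (λ v → K v s u′) Q }) ⟩
  Σsubs u (λ s u′ → extend (λ v → K v s u′) Q) ∎

extend-⊛-word : ∀ g P v → extend g (P ⊛ word v) ≋ extend (λ y → g (y ++ v)) P
extend-⊛-word g P v = ≋-trans (extend-resp g (⊛-word P v))
  (≋-trans (extend-extend g (λ u → word (u ++ v)) P) (extend-cong P (λ y → extend-word g (y ++ v))))

extend-word-⊛ : ∀ g u Q → extend g (word u ⊛ Q) ≋ extend (λ y → g (u ++ y)) Q
extend-word-⊛ g u Q = ≋-trans (extend-resp g (word-⊛ u Q))
  (≋-trans (extend-extend g (λ v → word (u ++ v)) Q) (extend-cong Q (λ y → extend-word g (u ++ y))))

extend-⟦gen,word⟧ : ∀ g K v → extend g ⟦ gen K , word v ⟧ ≋ g (K ∷ v) ⊕ neg (g (v ++ K ∷ []))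
extend-⟦gen,word⟧ g K v = ≋-trans (extend-⊕ g (gen K ⊛ word v) (neg (word v ⊛ gen K)))
  (⊕-cong (≋-trans (extend-resp g (word-⊛-word (K ∷ []) v)) (extend-word g (K ∷ v)))
          (≋-trans (extend-· g (- 1ℚ) (word v ⊛ gen K))
                   (neg-cong (≋-trans (extend-resp g (word-⊛-word v (K ∷ []))) (extend-word g (v ++ K ∷ []))))))

Σsubsₚ-⊛-word : ∀ P x G → Σsubsₚ (P ⊛ word x) G ≋ Σsubsₚ P (λ s u → Σsubs x (λ s′ v → G (s +ₙ s′) (u ++ v)))
Σsubsₚ-⊛-word P x G = ≋-trans (extend-⊛-word (λ w → Σsubs w G) P x)
                               (extend-cong P (λ u → Σsubs-++ u x G))

Σsubsₚ-word-⊛ : ∀ u Q G → Σsubsₚ (word u ⊛ Q) G ≋ Σsubs u (λ s u′ → Σsubsₚ Q (λ s′ v → G (s +ₙ s′) (u′ ++ v)))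
Σsubsₚ-word-⊛ u Q G = ≋-trans (extend-word-⊛ (λ w → Σsubs w G) u Q)
  (≋-trans (extend-cong Q (λ v → Σsubs-++ u v G))
           (extend-Σsubs u (λ v s u′ → Σsubs v (λ s′ v′ → G (s +ₙ s′) (u′ ++ v′))) Q))

bracketTerm : ℕ → ℕ → Word → Poly
bracketTerm i s u = ⟦ gen (suc (i +ₙ s)) , word u ⟧

dWord-letter : ∀ w a → dWord w (a ∷ []) ≋ dLetter w a
dWord-letter w a = ≋-trans (⊕-cong (⊛-word[] (dLetter w a)) (⊛-zeroʳ (word (a ∷ []))))
                           (≡⇒≋ (⊕-identityʳ _))

Σsubs-letter : ∀ k G → Σsubs (suc k ∷ []) G ≋ Δ k (λ a l → G a (suc l ∷ []))
Σsubs-letter k G = ≋-trans (Σsubs-b k [] G) (Δ-cong k (λ a l →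
  ≋-trans (Σsubs-[] (λ s u → G (a +ₙ s) (suc l ∷ u))) (≡⇒≋ (cong (λ n → G n (suc l ∷ [])) (ℕ.+-identityʳ a)))))

Σsubsₚ-⟦b,word⟧ : ∀ k v G → Σsubsₚ ⟦ gen (suc k) , word v ⟧ G
                   ≋ Σsubs v (λ s′ v′ → Δ k (λ a l → extend (G (a +ₙ s′)) ⟦ gen (suc l) , word v′ ⟧))
Σsubsₚ-⟦b,word⟧ k v G = begin
  Σsubsₚ ⟦ gen (suc k) , word v ⟧ G
    ≈⟨ extend-⟦gen,word⟧ (λ w → Σsubs w G) (suc k) v ⟩
  Σsubs (suc k ∷ v) G ⊕ neg (Σsubs (v ++ suc k ∷ []) G)
    ≈⟨ ⊕-cong (Σsubs-b k v G) (neg-cong (begin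
         Σsubs (v ++ suc k ∷ []) G
           ≈⟨ Σsubs-++ v (suc k ∷ []) G ⟩
         Σsubs v (λ s′ v′ → Σsubs (suc k ∷ []) (λ s u → G (s′ +ₙ s) (v′ ++ u)))
           ≈⟨ Σsubs-cong v (λ s′ v′ → ≋-trans (Σsubs-letter k (λ s u → G (s′ +ₙ s) (v′ ++ u)))
                (Δ-cong k (λ a l → ≡⇒≋ (cong (λ n → G n (v′ ++ suc l ∷ [])) (ℕ.+-comm s′ a))))) ⟩
         Σsubs v (λ s′ v′ → Δ k (λ a l → G (a +ₙ s′) (v′ ++ suc l ∷ [])))
           ≈⟨ Δ-Σsubs k v (λ a l s′ v′ → G (a +ₙ s′) (v′ ++ suc l ∷ [])) ⟨
         Δ k (λ a l → Σsubs v (λ s′ v′ → G (a +ₙ s′) (v′ ++ suc l ∷ []))) ∎)) ⟩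
  Δ k (λ a l → Σsubs v (λ s′ v′ → G (a +ₙ s′) (suc l ∷ v′)))
    ⊕ neg (Δ k (λ a l → Σsubs v (λ s′ v′ → G (a +ₙ s′) (v′ ++ suc l ∷ []))))
    ≈⟨ Δ-⊖ k (λ a l → Σsubs v (λ s′ v′ → G (a +ₙ s′) (suc l ∷ v′)))
             (λ a l → Σsubs v (λ s′ v′ → G (a +ₙ s′) (v′ ++ suc l ∷ []))) ⟨
  Δ k (λ a l → Σsubs v (λ s′ v′ → G (a +ₙ s′) (suc l ∷ v′))
               ⊕ neg (Σsubs v (λ s′ v′ → G (a +ₙ s′) (v′ ++ suc l ∷ []))))
    ≈⟨ Δ-cong k (λ a l → ≋-trans (≋-sym (Σsubs-⊖ v (λ s′ v′ → G (a +ₙ s′) (suc l ∷ v′))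
                                                     (λ s′ v′ → G (a +ₙ s′) (v′ ++ suc l ∷ []))))
                           (Σsubs-cong v (λ s′ v′ → ≋-sym (extend-⟦gen,word⟧ (G (a +ₙ s′)) (suc l) v′)))) ⟩
  Δ k (λ a l → Σsubs v (λ s′ v′ → extend (G (a +ₙ s′)) ⟦ gen (suc l) , word v′ ⟧))
    ≈⟨ Δ-Σsubs k v (λ a l s′ v′ → extend (G (a +ₙ s′)) ⟦ gen (suc l) , word v′ ⟧) ⟩
  Σsubs v (λ s′ v′ → Δ k (λ a l → extend (G (a +ₙ s′)) ⟦ gen (suc l) , word v′ ⟧)) ∎

Σsubsₚ-dLetter : ∀ a w G → Σsubsₚ (dLetter w a) G ≋ Σsubs (a ∷ []) (λ s u → extend (G s) (dWord w u))
Σsubsₚ-dLetter zero w G = ≋-sym (begin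
  Σsubs (zero ∷ []) (λ s u → extend (G s) (dWord w u))
    ≈⟨ ≋-trans (Σsubs-b₀ [] (λ s u → extend (G s) (dWord w u)))
               (Σsubs-[] (λ s u → extend (G s) (dWord w (zero ∷ u)))) ⟩
  extend (G 0) (word (zero ∷ []) ⊛ [])
    ≈⟨ extend-resp (G 0) (⊛-zeroʳ (word (zero ∷ []))) ⟩
  [] ∎)
Σsubsₚ-dLetter (suc k) w G = begin
  Σsubsₚ (dLetter w (suc k)) G
    ≈⟨ Σsubs-linear (extend-linear (λ w → Σsubs w G)) w (bracketTerm k) ⟩
  Σsubs w (λ t v → Σsubsₚ ⟦ gen (suc (k +ₙ t)) , word v ⟧ G)
    ≈⟨ Σsubs-cong w (λ t v → Σsubsₚ-⟦b,word⟧ (k +ₙ t) v G) ⟩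
  Σsubs w (λ t v → Σsubs v (λ s′ v′ → Δ (k +ₙ t) (λ a l → J (a +ₙ s′) l v′)))
    ≈⟨ Σsubs-Σsubs w (λ t s′ v′ → Δ (k +ₙ t) (λ a l → J (a +ₙ s′) l v′)) ⟩
  Σsubs w (λ n v′ → Σbinom n (λ t s′ → Δ (k +ₙ t) (λ a l → J (a +ₙ s′) l v′)))
    ≈⟨ Σsubs-cong w (λ n v′ → Σbinom-Δ n k (λ x l → J x l v′)) ⟩
  Σsubs w (λ n v′ → Δ k (λ a l → J a (l +ₙ n) v′))
    ≈⟨ Δ-Σsubs k w (λ a l n v′ → J a (l +ₙ n) v′) ⟨
  Δ k (λ a l → Σsubs w (λ n v′ → J a (l +ₙ n) v′))
    ≈⟨ Δ-cong k (λ a l → ≋-trans (extend-resp (G a) (dWord-letter w (suc l)))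
                                 (Σsubs-linear (extend-linear (G a)) w (bracketTerm l))) ⟨
  Δ k (λ a l → extend (G a) (dWord w (suc l ∷ [])))
    ≈⟨ Σsubs-letter k (λ s u → extend (G s) (dWord w u)) ⟨
  Σsubs (suc k ∷ []) (λ s u → extend (G s) (dWord w u)) ∎
  where
  J : ℕ → ℕ → Word → Poly
  J x l v′ = extend (G x) ⟦ gen (suc l) , word v′ ⟧

extend-dWord-++ : ∀ g w u v → extend g (dWord w (u ++ v))
                  ≋ extend (λ y → g (y ++ v)) (dWord w u) ⊕ extend (λ y → g (u ++ y)) (dWord w v)
extend-dWord-++ g w u v = begin
  extend g (dWord w (u ++ v))
    ≈⟨ extend-resp g (dWord-++ w u v) ⟩
  extend g (dWord w u ⊛ word v ⊕ word u ⊛ dWord w v)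
    ≈⟨ extend-⊕ g (dWord w u ⊛ word v) (word u ⊛ dWord w v) ⟩
  extend g (dWord w u ⊛ word v) ⊕ extend g (word u ⊛ dWord w v)
    ≈⟨ ⊕-cong (extend-⊛-word g (dWord w u) v) (extend-word-⊛ g u (dWord w v)) ⟩
  extend (λ y → g (y ++ v)) (dWord w u) ⊕ extend (λ y → g (u ++ y)) (dWord w v) ∎

-- The expansion Σsubs commutes with every ∂_w: this is the heart of the
-- bracket identity, and where the binomial coefficients in ∂ are needed.
Σsubsₚ-dWord : ∀ w x G → Σsubsₚ (dWord w x) G ≋ Σsubs x (λ s u → extend (G s) (dWord w u))
Σsubsₚ-dWord w [] G = ≋-sym (Σsubs-[] (λ s u → extend (G s) (dWord w u)))
Σsubsₚ-dWord w (a ∷ x) G = begin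
  Σsubsₚ (dLetter w a ⊛ word x ⊕ word (a ∷ []) ⊛ dWord w x) G
    ≈⟨ extend-⊕ (λ w → Σsubs w G) (dLetter w a ⊛ word x) (word (a ∷ []) ⊛ dWord w x) ⟩
  Σsubsₚ (dLetter w a ⊛ word x) G ⊕ Σsubsₚ (word (a ∷ []) ⊛ dWord w x) G
    ≈⟨ ⊕-cong (≋-trans (Σsubsₚ-⊛-word (dLetter w a) x G) (Σsubsₚ-dLetter a w G₁))
              (≋-trans (Σsubsₚ-word-⊛ (a ∷ []) (dWord w x) G)
                       (Σsubs-cong (a ∷ []) (λ s u → Σsubsₚ-dWord w x (λ s′ v → G (s +ₙ s′) (u ++ v))))) ⟩
  Σsubs (a ∷ []) (λ s u → extend (G₁ s) (dWord w u)) ⊕ Σsubs (a ∷ []) (λ s u → Σsubs x (R s u))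
    ≈⟨ Σsubs-⊕ (a ∷ []) (λ s u → extend (G₁ s) (dWord w u)) (λ s u → Σsubs x (R s u)) ⟨
  Σsubs (a ∷ []) (λ s u → extend (G₁ s) (dWord w u) ⊕ Σsubs x (R s u))
    ≈⟨ Σsubs-cong (a ∷ []) (λ s u → ⊕-congˡ (Σsubs x (R s u))
         (extend-Σsubs x (λ y s′ v → G (s +ₙ s′) (y ++ v)) (dWord w u))) ⟩
  Σsubs (a ∷ []) (λ s u → Σsubs x (L s u) ⊕ Σsubs x (R s u))
    ≈⟨ Σsubs-cong (a ∷ []) (λ s u → Σsubs-⊕ x (L s u) (R s u)) ⟨
  Σsubs (a ∷ []) (λ s u → Σsubs x (λ s′ v → L s u s′ v ⊕ R s u s′ v))
    ≈⟨ Σsubs-cong (a ∷ []) (λ s u → Σsubs-cong x (λ s′ v → ≋-sym (extend-dWord-++ (G (s +ₙ s′)) w u v))) ⟩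
  Σsubs (a ∷ []) (λ s u → Σsubs x (λ s′ v → extend (G (s +ₙ s′)) (dWord w (u ++ v))))
    ≈⟨ Σsubs-++ (a ∷ []) x (λ s y → extend (G s) (dWord w y)) ⟨
  Σsubs (a ∷ x) (λ s u → extend (G s) (dWord w u)) ∎
  where
  G₁ : ℕ → Word → Poly
  G₁ s u = Σsubs x (λ s′ v → G (s +ₙ s′) (u ++ v))
  L R : ℕ → Word → ℕ → Word → Poly
  L s u s′ v = extend (λ y → G (s +ₙ s′) (y ++ v)) (dWord w u)
  R s u s′ v = extend (λ y → G (s +ₙ s′) (u ++ y)) (dWord w v)

-- The bracket identity ∂_{ψ₁,ψ₂}_A = [∂_ψ₁, ∂_ψ₂]

jacobi : ∀ g U U′ → ⟦ g , U ⊛ U′ ⟧ ⊕ neg ⟦ g , U′ ⊛ U ⟧ ≋ ⟦ ⟦ g , U ⟧ , U′ ⟧ ⊕ neg ⟦ ⟦ g , U′ ⟧ , U ⟧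
jacobi g U U′ = begin
  ⟦ g , U ⊛ U′ ⟧ ⊕ neg ⟦ g , U′ ⊛ U ⟧
    ≈⟨ ⊕-cong (expand₁ U U′) (neg-cong (expand₁ U′ U)) ⟩
  ((g ⊛ U) ⊛ U′ ⊕ neg ((U ⊛ U′) ⊛ g)) ⊕ neg ((g ⊛ U′) ⊛ U ⊕ neg ((U′ ⊛ U) ⊛ g))
    ≈⟨ ≋-solve 6 (λ a b c d e f → (a ⊞ ⊟ b) ⊞ ⊟ (c ⊞ ⊟ d)
                                 ⊜ ((a ⊞ ⊟ e) ⊞ ⊟ (f ⊞ ⊟ d)) ⊞ ⊟ ((c ⊞ ⊟ f) ⊞ ⊟ (e ⊞ ⊟ b)))
         (λ _ → refl) ((g ⊛ U) ⊛ U′) ((U ⊛ U′) ⊛ g) ((g ⊛ U′) ⊛ U) ((U′ ⊛ U) ⊛ g) ((U ⊛ g) ⊛ U′) ((U′ ⊛ g) ⊛ U) ⟩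
  ((((g ⊛ U) ⊛ U′ ⊕ neg ((U ⊛ g) ⊛ U′)) ⊕ neg ((U′ ⊛ g) ⊛ U ⊕ neg ((U′ ⊛ U) ⊛ g)))
    ⊕ neg (((g ⊛ U′) ⊛ U ⊕ neg ((U′ ⊛ g) ⊛ U)) ⊕ neg ((U ⊛ g) ⊛ U′ ⊕ neg ((U ⊛ U′) ⊛ g))))
    ≈⟨ ⊕-cong (expand₂ U U′) (neg-cong (expand₂ U′ U)) ⟨
  ⟦ ⟦ g , U ⟧ , U′ ⟧ ⊕ neg ⟦ ⟦ g , U′ ⟧ , U ⟧ ∎
  where
  expand₁ : ∀ U U′ → ⟦ g , U ⊛ U′ ⟧ ≋ (g ⊛ U) ⊛ U′ ⊕ neg ((U ⊛ U′) ⊛ g)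
  expand₁ U U′ = ⊕-congˡ (neg ((U ⊛ U′) ⊛ g)) (≋-sym (⊛-assoc g U U′))
  expand₂ : ∀ U U′ → ⟦ ⟦ g , U ⟧ , U′ ⟧
                     ≋ ((g ⊛ U) ⊛ U′ ⊕ neg ((U ⊛ g) ⊛ U′)) ⊕ neg ((U′ ⊛ g) ⊛ U ⊕ neg ((U′ ⊛ U) ⊛ g))
  expand₂ U U′ = ⊕-cong
    (≋-trans (⊛-distribʳ (g ⊛ U) (neg (U ⊛ g)) U′) (⊕-congʳ ((g ⊛ U) ⊛ U′) (⊛-negˡ (U ⊛ g) U′)))
    (neg-cong (≋-trans (⊛-distribˡ U′ (g ⊛ U) (neg (U ⊛ g)))
      (⊕-cong (≋-sym (⊛-assoc U′ g U)) (≋-trans (⊛-negʳ U′ (U ⊛ g)) (neg-cong (≋-sym (⊛-assoc U′ U g)))))))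

bracketTerm-jacobi : ∀ i s u s′ u′ →
  bracketTerm i (s +ₙ s′) (u ++ u′) ⊕ neg (bracketTerm i (s′ +ₙ s) (u′ ++ u))
    ≋ ⟦ bracketTerm (i +ₙ s′) s u , word u′ ⟧ ⊕ neg ⟦ bracketTerm (i +ₙ s) s′ u′ , word u ⟧
bracketTerm-jacobi i s u s′ u′ = begin
  ⟦ g , word (u ++ u′) ⟧ ⊕ neg ⟦ gen (suc (i +ₙ (s′ +ₙ s))) , word (u′ ++ u) ⟧
    ≈⟨ ⊕-cong (⟦⟧-congʳ g (≋-sym (word-⊛-word u u′)))
              (neg-cong (≋-trans (≡⇒≋ (cong (λ n → ⟦ gen (suc (i +ₙ n)) , word (u′ ++ u) ⟧) (ℕ.+-comm s′ s)))
                                 (⟦⟧-congʳ g (≋-sym (word-⊛-word u′ u))))) ⟩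
  ⟦ g , word u ⊛ word u′ ⟧ ⊕ neg ⟦ g , word u′ ⊛ word u ⟧
    ≈⟨ jacobi g (word u) (word u′) ⟩
  ⟦ ⟦ g , word u ⟧ , word u′ ⟧ ⊕ neg ⟦ ⟦ g , word u′ ⟧ , word u ⟧
    ≡⟨ cong₂ (λ m n → ⟦ ⟦ gen (suc m) , word u ⟧ , word u′ ⟧ ⊕ neg ⟦ ⟦ gen (suc n) , word u′ ⟧ , word u ⟧)
             (trans (cong (i +ₙ_) (ℕ.+-comm s s′)) (sym (ℕ.+-assoc i s′ s))) (sym (ℕ.+-assoc i s s′)) ⟩
  ⟦ bracketTerm (i +ₙ s′) s u , word u′ ⟧ ⊕ neg ⟦ bracketTerm (i +ₙ s) s′ u′ , word u ⟧ ∎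
  where g = gen (suc (i +ₙ (s +ₙ s′)))

∂-gen : ∀ q i → ∂ q (gen (suc i)) ≋ Σsubsₚ q (bracketTerm i)
∂-gen q i = ≋-trans (∂-word q (suc i ∷ []))
  (extend-cong q (λ w → dWord-letter w (suc i)))

∂-b₀ : ∀ q → ∂ q (gen 0) ≋ []
∂-b₀ q = ≋-trans (∂-word q (zero ∷ []))
  (≋-trans (extend-cong q (λ w → dWord-letter w zero)) (extend-[]ᶠ q))

module _ (i : ℕ) where

  -- ∂ₓ (∂_y b) = outer x y ⊕ inner x y: in each bracket [b_{i+1+s}, u] of the
  -- expansion of ∂_y b, ∂ₓ hits either the letter or the word.
  inner outer : Word → Word → Poly
  inner x y = Σsubs y (λ s u → ⟦ gen (suc (i +ₙ s)) , dWord x u ⟧)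
  outer x y = Σsubs y (λ s u → Σsubs x (λ s′ u′ → ⟦ bracketTerm (i +ₙ s) s′ u′ , word u ⟧))

  ∂[∂]-gen : ∀ x y → ∂ (∂ (word x) (word y)) (gen (suc i)) ≋ inner x y
  ∂[∂]-gen x y = begin
    ∂ (∂ (word x) (word y)) (gen (suc i))
      ≈⟨ ≋-resp (∂-linearˡ (gen (suc i))) (∂-word-word x y) ⟩
    ∂ (dWord x y) (gen (suc i))
      ≈⟨ ∂-gen (dWord x y) i ⟩
    Σsubsₚ (dWord x y) (bracketTerm i)
      ≈⟨ Σsubsₚ-dWord x y (bracketTerm i) ⟩
    Σsubs y (λ s u → extend (bracketTerm i s) (dWord x u))
      ≈⟨ Σsubs-cong y (λ s u → ≋-sym (linear≋extend (⟦⟧ʳ-linear (gen (suc (i +ₙ s)))) (dWord x u))) ⟩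
    inner x y ∎

  ∂∘∂-gen : ∀ x y → ∂ (word x) (∂ (word y) (gen (suc i))) ≋ outer x y ⊕ inner x y
  ∂∘∂-gen x y = begin
    ∂ (word x) (∂ (word y) (gen (suc i)))
      ≈⟨ ≋-resp (∂-linearʳ (word x)) (≋-trans (∂-gen (word y) i) (extend-word (λ w → Σsubs w (bracketTerm i)) y)) ⟩
    ∂ (word x) (Σsubs y (bracketTerm i))
      ≈⟨ Σsubs-linear (∂-linearʳ (word x)) y (bracketTerm i) ⟩
    Σsubs y (λ s u → ∂ (word x) (bracketTerm i s u))
      ≈⟨ Σsubs-cong y (λ s u → ≋-trans (∂-⟦⟧ (word x) (gen (suc (i +ₙ s))) (word u))
           (⊕-cong (≋-trans (⟦⟧-congˡ (word u) (≋-trans (∂-gen (word x) (i +ₙ s))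
                                                         (extend-word (λ w → Σsubs w (bracketTerm (i +ₙ s))) x)))
                            (Σsubs-linear (⟦⟧ˡ-linear (word u)) x (bracketTerm (i +ₙ s))))
                   (⟦⟧-congʳ (gen (suc (i +ₙ s))) (∂-word-word x u)))) ⟩
    Σsubs y (λ s u → Σsubs x (λ s′ u′ → ⟦ bracketTerm (i +ₙ s) s′ u′ , word u ⟧) ⊕ ⟦ gen (suc (i +ₙ s)) , dWord x u ⟧)
      ≈⟨ Σsubs-⊕ y (λ s u → Σsubs x (λ s′ u′ → ⟦ bracketTerm (i +ₙ s) s′ u′ , word u ⟧))
                   (λ s u → ⟦ gen (suc (i +ₙ s)) , dWord x u ⟧) ⟩
    outer x y ⊕ inner x y ∎

  ∂⟦⟧-gen : ∀ x y → ∂ ⟦ word x , word y ⟧ (gen (suc i)) ≋ outer x y ⊕ neg (outer y x)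
  ∂⟦⟧-gen x y = begin
    ∂ ⟦ word x , word y ⟧ (gen (suc i))
      ≈⟨ ∂-gen ⟦ word x , word y ⟧ i ⟩
    Σsubsₚ (word x ⊛ word y ⊕ neg (word y ⊛ word x)) (bracketTerm i)
      ≈⟨ ≋-trans (extend-⊕ f (word x ⊛ word y) (neg (word y ⊛ word x)))
                 (⊕-congʳ (extend f (word x ⊛ word y)) (extend-· f (- 1ℚ) (word y ⊛ word x))) ⟩
    extend f (word x ⊛ word y) ⊕ neg (extend f (word y ⊛ word x))
      ≈⟨ ⊕-cong (≋-trans (extend-resp f (word-⊛-word x y)) (extend-word f (x ++ y)))
                (neg-cong (≋-trans (extend-resp f (word-⊛-word y x)) (extend-word f (y ++ x)))) ⟩
    Σsubs (x ++ y) (bracketTerm i) ⊕ neg (Σsubs (y ++ x) (bracketTerm i))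
      ≈⟨ ⊕-cong (Σsubs-++ x y (bracketTerm i))
                (neg-cong (≋-trans (Σsubs-++ y x (bracketTerm i))
                                   (Σsubs-comm y x (λ s′ u′ s u → bracketTerm i (s′ +ₙ s) (u′ ++ u))))) ⟩
    Σsubs x (λ s u → Σsubs y (A s u)) ⊕ neg (Σsubs x (λ s u → Σsubs y (B s u)))
      ≈⟨ ≋-trans (Σsubs-cong x (λ s u → Σsubs-⊖ y (A s u) (B s u)))
                 (Σsubs-⊖ x (λ s u → Σsubs y (A s u)) (λ s u → Σsubs y (B s u))) ⟨
    Σsubs x (λ s u → Σsubs y (λ s′ u′ → A s u s′ u′ ⊕ neg (B s u s′ u′)))
      ≈⟨ Σsubs-cong x (λ s u → Σsubs-cong y (λ s′ u′ → bracketTerm-jacobi i s u s′ u′)) ⟩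
    Σsubs x (λ s u → Σsubs y (λ s′ u′ → A′ s u s′ u′ ⊕ neg (outerTerm s u s′ u′)))
      ≈⟨ ≋-trans (Σsubs-cong x (λ s u → Σsubs-⊖ y (A′ s u) (outerTerm s u)))
                 (Σsubs-⊖ x (λ s u → Σsubs y (A′ s u)) (λ s u → Σsubs y (outerTerm s u))) ⟩
    Σsubs x (λ s u → Σsubs y (A′ s u)) ⊕ neg (outer y x)
      ≈⟨ ⊕-congˡ (neg (outer y x)) (Σsubs-comm y x (λ s′ u′ s u → ⟦ bracketTerm (i +ₙ s′) s u , word u′ ⟧)) ⟨
    outer x y ⊕ neg (outer y x) ∎
    where
    f = λ w → Σsubs w (bracketTerm i)
    A B A′ outerTerm : ℕ → Word → ℕ → Word → Poly
    A s u s′ u′ = bracketTerm i (s +ₙ s′) (u ++ u′)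
    B s u s′ u′ = bracketTerm i (s′ +ₙ s) (u′ ++ u)
    A′ s u s′ u′ = ⟦ bracketTerm (i +ₙ s′) s u , word u′ ⟧
    outerTerm s u s′ u′ = ⟦ bracketTerm (i +ₙ s) s′ u′ , word u ⟧
  ∂-braceA-gen : ∀ x y → ∂ (braceA (word x) (word y)) (gen (suc i))
                         ≋ ∂ (word x) (∂ (word y) (gen (suc i))) ⊕ neg (∂ (word y) (∂ (word x) (gen (suc i))))
  ∂-braceA-gen x y = begin
    ∂ (braceA (word x) (word y)) b
      ≈⟨ ≋-trans (⊕-hom L (∂ (word x) (word y) ⊕ neg (∂ (word y) (word x))) ⟦ word x , word y ⟧)
           (⊕-congˡ (∂ ⟦ word x , word y ⟧ b) (≋-trans (⊕-hom L (∂ (word x) (word y)) (neg (∂ (word y) (word x))))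
                                                  (⊕-congʳ (∂ (∂ (word x) (word y)) b) (·-hom L (- 1ℚ) (∂ (word y) (word x)))))) ⟩
    (∂ (∂ (word x) (word y)) b ⊕ neg (∂ (∂ (word y) (word x)) b)) ⊕ ∂ ⟦ word x , word y ⟧ b
      ≈⟨ ⊕-cong (⊕-cong (∂[∂]-gen x y) (neg-cong (∂[∂]-gen y x))) (∂⟦⟧-gen x y) ⟩
    (inner x y ⊕ neg (inner y x)) ⊕ (outer x y ⊕ neg (outer y x))
      ≈⟨ ≋-solve 4 (λ a b c d → (a ⊞ ⊟ b) ⊞ (c ⊞ ⊟ d) ⊜ (c ⊞ a) ⊞ ⊟ (d ⊞ b)) (λ _ → refl)
           (inner x y) (inner y x) (outer x y) (outer y x) ⟩
    (outer x y ⊕ inner x y) ⊕ neg (outer y x ⊕ inner y x)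
      ≈⟨ ⊕-cong (∂∘∂-gen x y) (neg-cong (∂∘∂-gen y x)) ⟨
    ∂ (word x) (∂ (word y) b) ⊕ neg (∂ (word y) (∂ (word x) b)) ∎
    where
    b = gen (suc i)
    L = ∂-linearˡ b

∂-braceA-words : ∀ x y p → ∂ (braceA (word x) (word y)) p
                           ≋ ∂ (word x) (∂ (word y) p) ⊕ neg (∂ (word y) (∂ (word x) p))
∂-braceA-words x y = derivation-ext (∂-derivation (braceA (word x) (word y)))
  (commutator-derivation (∂-derivation (word x)) (∂-derivation (word y))) on-letters
  where
  on-letters : ∀ a → ∂ (braceA (word x) (word y)) (gen a)
                     ≋ ∂ (word x) (∂ (word y) (gen a)) ⊕ neg (∂ (word y) (∂ (word x) (gen a)))
  on-letters zero = ≋-trans (∂-b₀ (braceA (word x) (word y))) (≋-sym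
    (⊕-cong (≋-trans (≋-resp (∂-linearʳ (word x)) (∂-b₀ (word y))) ([]-hom (∂-linearʳ (word x))))
            (neg-cong (≋-trans (≋-resp (∂-linearʳ (word y)) (∂-b₀ (word x))) ([]-hom (∂-linearʳ (word y)))))))
  on-letters (suc i) = ∂-braceA-gen i x y

braceA-linearˡ : ∀ ψ₂ → IsLinear (λ ψ₁ → braceA ψ₁ ψ₂)
braceA-linearˡ ψ₂ = ⊕-linear (⊕-linear (∂-linearˡ ψ₂) (neg-linear (∂-linearʳ ψ₂))) (⟦⟧ˡ-linear ψ₂)

braceA-linearʳ : ∀ ψ₁ → IsLinear (braceA ψ₁)
braceA-linearʳ ψ₁ = ⊕-linear (⊕-linear (∂-linearʳ ψ₁) (neg-linear (∂-linearˡ ψ₁))) (⟦⟧ʳ-linear ψ₁)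

∂-braceA : ∀ ψ₁ ψ₂ p → ∂ (braceA ψ₁ ψ₂) p ≋ ∂ ψ₁ (∂ ψ₂ p) ⊕ neg (∂ ψ₂ (∂ ψ₁ p))
∂-braceA ψ₁ ψ₂ p =
  linear-ext (∘-linear (∂-linearˡ p) (braceA-linearˡ ψ₂))
             (⊕-linear (∂-linearˡ (∂ ψ₂ p)) (neg-linear (∘-linear (∂-linearʳ ψ₂) (∂-linearˡ p))))
             (λ x → linear-ext (∘-linear (∂-linearˡ p) (braceA-linearʳ (word x)))
                               (⊕-linear (∘-linear (∂-linearʳ (word x)) (∂-linearˡ p))
                                         (neg-linear (∂-linearˡ (∂ (word x) p))))
                               (λ y → ∂-braceA-words x y p) ψ₂)
             ψ₁

σ-linearʳ : ∀ ψ → IsLinear (σ ψ)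
σ-linearʳ ψ = ⊕-linear (⊛ʳ-linear ψ) (∂-linearʳ ψ)

σ-linearˡ : ∀ y → IsLinear (λ ψ → σ ψ y)
σ-linearˡ y = ⊕-linear (⊛ˡ-linear y) (∂-linearˡ y)

σ∘σ : ∀ x y p → σ x (σ y p) ≋ (((x ⊛ y) ⊛ p ⊕ x ⊛ ∂ y p) ⊕ (∂ x y ⊛ p ⊕ y ⊛ ∂ x p)) ⊕ ∂ x (∂ y p)
σ∘σ x y p = begin
  x ⊛ (y ⊛ p ⊕ ∂ y p) ⊕ ∂ x (y ⊛ p ⊕ ∂ y p)
    ≈⟨ ⊕-cong (≋-trans (⊛-distribˡ x (y ⊛ p) (∂ y p)) (⊕-congˡ (x ⊛ ∂ y p) (≋-sym (⊛-assoc x y p))))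
              (≋-trans (⊕-hom (∂-linearʳ x) (y ⊛ p) (∂ y p)) (⊕-congˡ (∂ x (∂ y p)) (∂-leibniz x y p))) ⟩
  ((x ⊛ y) ⊛ p ⊕ x ⊛ ∂ y p) ⊕ ((∂ x y ⊛ p ⊕ y ⊛ ∂ x p) ⊕ ∂ x (∂ y p))
    ≈⟨ ≋-solve 3 (λ a b c → a ⊞ (b ⊞ c) ⊜ (a ⊞ b) ⊞ c) (λ _ → refl)
         ((x ⊛ y) ⊛ p ⊕ x ⊛ ∂ y p) (∂ x y ⊛ p ⊕ y ⊛ ∂ x p) (∂ x (∂ y p)) ⟩
  (((x ⊛ y) ⊛ p ⊕ x ⊛ ∂ y p) ⊕ (∂ x y ⊛ p ⊕ y ⊛ ∂ x p)) ⊕ ∂ x (∂ y p) ∎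

σ-braceA : ∀ ψ₁ ψ₂ p → σ (braceA ψ₁ ψ₂) p ≋ σ ψ₁ (σ ψ₂ p) ⊕ neg (σ ψ₂ (σ ψ₁ p))
σ-braceA ψ₁ ψ₂ p = begin
  braceA ψ₁ ψ₂ ⊛ p ⊕ ∂ (braceA ψ₁ ψ₂) p
    ≈⟨ ⊕-cong (≋-trans (⊛-distribʳ (∂ ψ₁ ψ₂ ⊕ neg (∂ ψ₂ ψ₁)) ⟦ ψ₁ , ψ₂ ⟧ p)
                (⊕-cong (≋-trans (⊛-distribʳ (∂ ψ₁ ψ₂) (neg (∂ ψ₂ ψ₁)) p) (⊕-congʳ (∂ ψ₁ ψ₂ ⊛ p) (⊛-negˡ (∂ ψ₂ ψ₁) p)))
                        (≋-trans (⊛-distribʳ (ψ₁ ⊛ ψ₂) (neg (ψ₂ ⊛ ψ₁)) p) (⊕-congʳ ((ψ₁ ⊛ ψ₂) ⊛ p) (⊛-negˡ (ψ₂ ⊛ ψ₁) p)))))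
              (∂-braceA ψ₁ ψ₂ p) ⟩
  ((∂ ψ₁ ψ₂ ⊛ p ⊕ neg (∂ ψ₂ ψ₁ ⊛ p)) ⊕ ((ψ₁ ⊛ ψ₂) ⊛ p ⊕ neg ((ψ₂ ⊛ ψ₁) ⊛ p)))
    ⊕ (∂ ψ₁ (∂ ψ₂ p) ⊕ neg (∂ ψ₂ (∂ ψ₁ p)))
    ≈⟨ ≋-solve 8 (λ a₁ a₂ a₃ a₄ a₅ b₁ b₃ b₅ →
           ((a₃ ⊞ ⊟ b₃) ⊞ (a₁ ⊞ ⊟ b₁)) ⊞ (a₅ ⊞ ⊟ b₅)
         ⊜ (((a₁ ⊞ a₂) ⊞ (a₃ ⊞ a₄)) ⊞ a₅) ⊞ ⊟ (((b₁ ⊞ a₄) ⊞ (b₃ ⊞ a₂)) ⊞ b₅))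
         (λ _ → refl) ((ψ₁ ⊛ ψ₂) ⊛ p) (ψ₁ ⊛ ∂ ψ₂ p) (∂ ψ₁ ψ₂ ⊛ p) (ψ₂ ⊛ ∂ ψ₁ p) (∂ ψ₁ (∂ ψ₂ p))
                      ((ψ₂ ⊛ ψ₁) ⊛ p) (∂ ψ₂ ψ₁ ⊛ p) (∂ ψ₂ (∂ ψ₁ p)) ⟩
  ((((ψ₁ ⊛ ψ₂) ⊛ p ⊕ ψ₁ ⊛ ∂ ψ₂ p) ⊕ (∂ ψ₁ ψ₂ ⊛ p ⊕ ψ₂ ⊛ ∂ ψ₁ p)) ⊕ ∂ ψ₁ (∂ ψ₂ p))
    ⊕ neg ((((ψ₂ ⊛ ψ₁) ⊛ p ⊕ ψ₂ ⊛ ∂ ψ₁ p) ⊕ (∂ ψ₂ ψ₁ ⊛ p ⊕ ψ₁ ⊛ ∂ ψ₂ p)) ⊕ ∂ ψ₂ (∂ ψ₁ p))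
    ≈⟨ ⊕-cong (σ∘σ ψ₁ ψ₂ p) (neg-cong (σ∘σ ψ₂ ψ₁ p)) ⟨
  σ ψ₁ (σ ψ₂ p) ⊕ neg (σ ψ₂ (σ ψ₁ p)) ∎

-- Passage to ℚ⟨B⟩⁰

π₀-coeff-b₀ : ∀ p w → endsIn0 w ≡ true → coeff (π₀ p) w ≡ 0ℚ
π₀-coeff-b₀ [] w w-b₀ = refl
π₀-coeff-b₀ ((c , u) ∷ p) w w-b₀ with endsIn0 u in u-b₀
... | true = π₀-coeff-b₀ p w w-b₀
... | false with ≡-dec ℕ._≟_ u w
...   | yes refl with () ← trans (sym u-b₀) w-b₀
...   | no _ = π₀-coeff-b₀ p w w-b₀

π₀-coeff-¬b₀ : ∀ p w → endsIn0 w ≡ false → coeff (π₀ p) w ≡ coeff p w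
π₀-coeff-¬b₀ [] w w-¬b₀ = refl
π₀-coeff-¬b₀ ((c , u) ∷ p) w w-¬b₀ with endsIn0 u in u-b₀
... | true with ≡-dec ℕ._≟_ u w
...   | yes refl with () ← trans (sym w-¬b₀) u-b₀
...   | no _ = π₀-coeff-¬b₀ p w w-¬b₀
π₀-coeff-¬b₀ ((c , u) ∷ p) w w-¬b₀ | false with ≡-dec ℕ._≟_ u w
...   | yes _ = cong (c +_) (π₀-coeff-¬b₀ p w w-¬b₀)
...   | no _ = π₀-coeff-¬b₀ p w w-¬b₀

π₀-≋ : ∀ p {q} → (∀ w → endsIn0 w ≡ true → coeff q w ≡ 0ℚ) →
       (∀ w → endsIn0 w ≡ false → coeff p w ≡ coeff q w) → π₀ p ≋ q
π₀-≋ p {q} q-b₀ p≡q = ⟨ coeffwise ⟩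
  where
  coeffwise : ∀ w → coeff (π₀ p) w ≡ coeff q w
  coeffwise w with endsIn0 w in w-b₀
  ... | true = trans (π₀-coeff-b₀ p w w-b₀) (sym (q-b₀ w w-b₀))
  ... | false = trans (π₀-coeff-¬b₀ p w w-b₀) (p≡q w w-b₀)

π₀-linear : IsLinear π₀
π₀-linear = record
  { ≋-resp = λ {p} {q} p≋q → π₀-≋ p (λ w → π₀-coeff-b₀ q w)
      (λ w w-¬b₀ → trans (coeff-≡ p≋q w) (sym (π₀-coeff-¬b₀ q w w-¬b₀)))
  ; ⊕-hom = λ p q → π₀-≋ (p ⊕ q)
      (λ w w-b₀ → trans (coeff-⊕ (π₀ p) (π₀ q) w)
                        (trans (cong₂ _+_ (π₀-coeff-b₀ p w w-b₀) (π₀-coeff-b₀ q w w-b₀)) (ℚ.+-identityˡ 0ℚ)))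
      (λ w w-¬b₀ → trans (coeff-⊕ p q w) (sym (trans (coeff-⊕ (π₀ p) (π₀ q) w)
                        (cong₂ _+_ (π₀-coeff-¬b₀ p w w-¬b₀) (π₀-coeff-¬b₀ q w w-¬b₀)))))
  ; ·-hom = λ a p → π₀-≋ (a · p)
      (λ w w-b₀ → trans (coeff-· a (π₀ p) w) (trans (cong (a *_) (π₀-coeff-b₀ p w w-b₀)) (ℚ.*-zeroʳ a)))
      (λ w w-¬b₀ → trans (coeff-· a p w) (sym (trans (coeff-· a (π₀ p) w) (cong (a *_) (π₀-coeff-¬b₀ p w w-¬b₀)))))
  }

π₀-idem : ∀ p → π₀ (π₀ p) ≋ π₀ p
π₀-idem p = π₀-≋ (π₀ p) (π₀-coeff-b₀ p) (λ _ _ → refl)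

endsIn0-++b₀ : ∀ v → endsIn0 (v ++ zero ∷ []) ≡ true
endsIn0-++b₀ [] = refl
endsIn0-++b₀ (zero ∷ []) = refl
endsIn0-++b₀ (suc a ∷ []) = refl
endsIn0-++b₀ (zero ∷ b ∷ v) = endsIn0-++b₀ (b ∷ v)
endsIn0-++b₀ (suc a ∷ b ∷ v) = endsIn0-++b₀ (b ∷ v)

endsIn0⇒++b₀ : ∀ u → endsIn0 u ≡ true → Σ Word (λ u′ → u ≡ u′ ++ zero ∷ [])
endsIn0⇒++b₀ (zero ∷ []) _ = [] , refl
endsIn0⇒++b₀ (zero ∷ b ∷ u) u-b₀ with endsIn0⇒++b₀ (b ∷ u) u-b₀
... | u′ , bu≡u′b₀ = (zero ∷ u′) , cong (zero ∷_) bu≡u′b₀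
endsIn0⇒++b₀ (suc a ∷ b ∷ u) u-b₀ with endsIn0⇒++b₀ (b ∷ u) u-b₀
... | u′ , bu≡u′b₀ = (suc a ∷ u′) , cong (suc a ∷_) bu≡u′b₀

π₀-⊛b₀ : ∀ X → π₀ (X ⊛ gen 0) ≋ []
π₀-⊛b₀ X = begin
  π₀ (X ⊛ gen 0)
    ≈⟨ ≋-resp π₀-linear (⊛-word X (zero ∷ [])) ⟩
  π₀ (extend (λ v → word (v ++ zero ∷ [])) X)
    ≈⟨ linear-extend π₀-linear (λ v → word (v ++ zero ∷ [])) X ⟩
  extend (λ v → π₀ (word (v ++ zero ∷ []))) X
    ≈⟨ extend-cong X (λ v → ≡⇒≋ (cong (λ b → if b then [] else word (v ++ zero ∷ [])) (endsIn0-++b₀ v))) ⟩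
  extend (λ _ → []) X
    ≈⟨ extend-[]ᶠ X ⟩
  [] ∎

∂-⊛b₀ : ∀ ψ X → ∂ ψ (X ⊛ gen 0) ≋ ∂ ψ X ⊛ gen 0
∂-⊛b₀ ψ X = begin
  ∂ ψ (X ⊛ gen 0)                   ≈⟨ ∂-leibniz ψ X (gen 0) ⟩
  ∂ ψ X ⊛ gen 0 ⊕ X ⊛ ∂ ψ (gen 0)   ≈⟨ ⊕-congʳ (∂ ψ X ⊛ gen 0) (≋-trans (⊛-congʳ X (∂-b₀ ψ)) (⊛-zeroʳ X)) ⟩
  ∂ ψ X ⊛ gen 0 ⊕ []                ≡⟨ ⊕-identityʳ _ ⟩
  ∂ ψ X ⊛ gen 0                     ∎

-- σ_ψ maps ℚ⟨B⟩b₀ into itself because ∂_ψ b₀ = 0.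
σ-b₀ : ∀ ψ u → endsIn0 u ≡ true → π₀ (σ ψ (word u)) ≋ []
σ-b₀ ψ u u-b₀ with endsIn0⇒++b₀ u u-b₀
... | u′ , refl = begin
  π₀ (σ ψ (word (u′ ++ zero ∷ [])))
    ≈⟨ ≋-resp (∘-linear π₀-linear (σ-linearʳ ψ)) (word-⊛-word u′ (zero ∷ [])) ⟨
  π₀ (ψ ⊛ (word u′ ⊛ gen 0) ⊕ ∂ ψ (word u′ ⊛ gen 0))
    ≈⟨ ≋-resp π₀-linear (⊕-cong (≋-sym (⊛-assoc ψ (word u′) (gen 0))) (∂-⊛b₀ ψ (word u′))) ⟩
  π₀ ((ψ ⊛ word u′) ⊛ gen 0 ⊕ ∂ ψ (word u′) ⊛ gen 0)
    ≈⟨ ≋-resp π₀-linear (⊛-distribʳ (ψ ⊛ word u′) (∂ ψ (word u′)) (gen 0)) ⟨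
  π₀ ((ψ ⊛ word u′ ⊕ ∂ ψ (word u′)) ⊛ gen 0)
    ≈⟨ π₀-⊛b₀ (ψ ⊛ word u′ ⊕ ∂ ψ (word u′)) ⟩
  [] ∎

π₀-σ-π₀ : ∀ ψ y → π₀ (σ ψ (π₀ y)) ≋ π₀ (σ ψ y)
π₀-σ-π₀ ψ y = linear-ext (∘-linear π₀-linear (∘-linear (σ-linearʳ ψ) π₀-linear))
                         (∘-linear π₀-linear (σ-linearʳ ψ)) on-words y
  where
  on-words : ∀ u → π₀ (σ ψ (π₀ (word u))) ≋ π₀ (σ ψ (word u))
  on-words u with endsIn0 u in u-b₀
  ... | true = ≋-trans ([]-hom (∘-linear π₀-linear (σ-linearʳ ψ))) (≋-sym (σ-b₀ ψ u u-b₀))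
  ... | false = ≋-refl

σ⁰-linearʳ : ∀ ψ → IsLinear (σ⁰ ψ)
σ⁰-linearʳ ψ = ∘-linear π₀-linear (σ-linearʳ ψ)

σ⁰-linearˡ : ∀ y → IsLinear (λ ψ → σ⁰ ψ y)
σ⁰-linearˡ y = ∘-linear π₀-linear (σ-linearˡ y)

σ⁰-braceA : ∀ ψ₁ ψ₂ y → σ⁰ (braceA ψ₁ ψ₂) y ≋ σ⁰ ψ₁ (σ⁰ ψ₂ y) ⊕ neg (σ⁰ ψ₂ (σ⁰ ψ₁ y))
σ⁰-braceA ψ₁ ψ₂ y = begin
  π₀ (σ (braceA ψ₁ ψ₂) y)
    ≈⟨ ≋-resp π₀-linear (σ-braceA ψ₁ ψ₂ y) ⟩
  π₀ (σ ψ₁ (σ ψ₂ y) ⊕ neg (σ ψ₂ (σ ψ₁ y)))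
    ≈⟨ ≋-trans (⊕-hom π₀-linear (σ ψ₁ (σ ψ₂ y)) (neg (σ ψ₂ (σ ψ₁ y))))
               (⊕-congʳ (π₀ (σ ψ₁ (σ ψ₂ y))) (·-hom π₀-linear (- 1ℚ) (σ ψ₂ (σ ψ₁ y)))) ⟩
  π₀ (σ ψ₁ (σ ψ₂ y)) ⊕ neg (π₀ (σ ψ₂ (σ ψ₁ y)))
    ≈⟨ ⊕-cong (π₀-σ-π₀ ψ₁ (σ ψ₂ y)) (neg-cong (π₀-σ-π₀ ψ₂ (σ ψ₁ y))) ⟨
  σ⁰ ψ₁ (σ⁰ ψ₂ y) ⊕ neg (σ⁰ ψ₂ (σ⁰ ψ₁ y)) ∎

In0⇒π₀≋ : ∀ x → In0 x → π₀ x ≋ x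
In0⇒π₀≋ x x∈ = ⟨ x∈ ⟩

In0-π₀ : ∀ p → In0 (π₀ p)
In0-π₀ p = coeff-≡ (π₀-idem p)

In0-resp : ∀ {p q} → p ≋ q → In0 q → In0 p
In0-resp {p} {q} p≋q q∈ = coeff-≡ (≋-trans (≋-resp π₀-linear p≋q) (≋-trans (In0⇒π₀≋ q q∈) (≋-sym p≋q)))

In0-⊕ : ∀ x y → In0 x → In0 y → In0 (x ⊕ y)
In0-⊕ x y x∈ y∈ = coeff-≡ (≋-trans (⊕-hom π₀-linear x y) (⊕-cong (In0⇒π₀≋ x x∈) (In0⇒π₀≋ y y∈)))

In0-· : ∀ a x → In0 x → In0 (a · x)
In0-· a x x∈ = coeff-≡ (≋-trans (·-hom π₀-linear a x) (·-cong a (In0⇒π₀≋ x x∈)))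

σ⁰-end : ∀ ψ → IsEnd⁰ (σ⁰ ψ)
σ⁰-end ψ = record
  { resp = λ {x} {y} _ _ x≈y → coeff-≡ (≋-resp (σ⁰-linearʳ ψ) {x} {y} ⟨ x≈y ⟩)
  ; additive = λ x y _ _ → coeff-≡ (⊕-hom (σ⁰-linearʳ ψ) x y)
  ; homog = λ a x _ → coeff-≡ (·-hom (σ⁰-linearʳ ψ) a x)
  ; into = λ x _ → In0-π₀ (σ ψ x)
  }

-- The adjoint action

module _ {T : Poly → Poly} (T-end : IsEnd⁰ T) where

  end-resp : ∀ {x y} → In0 x → In0 y → x ≋ y → T x ≋ T y
  end-resp x∈ y∈ x≋y = ⟨ IsEnd⁰.resp T-end x∈ y∈ (coeff-≡ x≋y) ⟩

  end-⊕ : ∀ x y → In0 x → In0 y → T (x ⊕ y) ≋ T x ⊕ T y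
  end-⊕ x y x∈ y∈ = ⟨ IsEnd⁰.additive T-end x y x∈ y∈ ⟩

  end-· : ∀ a x → In0 x → T (a · x) ≋ a · T x
  end-· a x x∈ = ⟨ IsEnd⁰.homog T-end a x x∈ ⟩

  end-⊖ : ∀ x y → In0 x → In0 y → T (x ⊕ neg y) ≋ T x ⊕ neg (T y)
  end-⊖ x y x∈ y∈ = ≋-trans (end-⊕ x (neg y) x∈ (In0-· (- 1ℚ) y y∈)) (⊕-congʳ (T x) (end-· (- 1ℚ) y y∈))

ad : (Poly → Poly) → (Poly → Poly) → Poly → Poly
ad S t x = S (t x) ⊕ neg (t (S x))

module _ {S₁ S₂ : Poly → Poly} (S₁-end : IsEnd⁰ S₁) (S₂-end : IsEnd⁰ S₂)
         {t : Poly → Poly} (t-end : IsEnd⁰ t) where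

  private
    module S₁ = IsEnd⁰ S₁-end
    module S₂ = IsEnd⁰ S₂-end
    module T = IsEnd⁰ t-end

  ad-linear : ∀ {S} a b → (∀ x → In0 x → S x ≋ a · S₁ x ⊕ b · S₂ x) →
              ∀ x → In0 x → ad S t x ≋ a · ad S₁ t x ⊕ b · ad S₂ t x
  ad-linear {S} a b S≋ x x∈ = begin
    S (t x) ⊕ neg (t (S x))
      ≈⟨ ⊕-cong (S≋ (t x) (T.into x x∈)) (neg-cong t∘S≋) ⟩
    (a · S₁ (t x) ⊕ b · S₂ (t x)) ⊕ neg (a · t (S₁ x) ⊕ b · t (S₂ x))
      ≈⟨ ≋-solve 4 (λ p q r s → (p ⊞ r) ⊞ ⊟ (q ⊞ s) ⊜ (p ⊞ ⊟ q) ⊞ (r ⊞ ⊟ s)) (λ _ → refl)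
           (a · S₁ (t x)) (a · t (S₁ x)) (b · S₂ (t x)) (b · t (S₂ x)) ⟩
    (a · S₁ (t x) ⊕ neg (a · t (S₁ x))) ⊕ (b · S₂ (t x) ⊕ neg (b · t (S₂ x)))
      ≈⟨ ⊕-cong (·-⊖ a (S₁ (t x)) (t (S₁ x))) (·-⊖ b (S₂ (t x)) (t (S₂ x))) ⟨
    a · ad S₁ t x ⊕ b · ad S₂ t x ∎
    where
    ·-⊖ : ∀ c p q → c · (p ⊕ neg q) ≋ c · p ⊕ neg (c · q)
    ·-⊖ c p q = ≋-trans (≡⇒≋ (·-⊕ c p (neg q))) (⊕-congʳ (c · p) (·-comm c (- 1ℚ) q))
    aS₁x∈ = In0-· a (S₁ x) (S₁.into x x∈)
    bS₂x∈ = In0-· b (S₂ x) (S₂.into x x∈)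
    combination∈ = In0-⊕ (a · S₁ x) (b · S₂ x) aS₁x∈ bS₂x∈
    t∘S≋ : t (S x) ≋ a · t (S₁ x) ⊕ b · t (S₂ x)
    t∘S≋ = begin
      t (S x)
        ≈⟨ end-resp t-end (In0-resp (S≋ x x∈) combination∈) combination∈ (S≋ x x∈) ⟩
      t (a · S₁ x ⊕ b · S₂ x)
        ≈⟨ end-⊕ t-end (a · S₁ x) (b · S₂ x) aS₁x∈ bS₂x∈ ⟩
      t (a · S₁ x) ⊕ t (b · S₂ x)
        ≈⟨ ⊕-cong (end-· t-end a (S₁ x) (S₁.into x x∈)) (end-· t-end b (S₂ x) (S₂.into x x∈)) ⟩
      a · t (S₁ x) ⊕ b · t (S₂ x) ∎

  ad-commutator : ∀ {S} → (∀ x → In0 x → S x ≋ S₁ (S₂ x) ⊕ neg (S₂ (S₁ x))) →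
                  ∀ x → In0 x → ad S t x ≋ ad S₁ (ad S₂ t) x ⊕ neg (ad S₂ (ad S₁ t) x)
  ad-commutator {S} S≋ x x∈ = begin
    S (t x) ⊕ neg (t (S x))
      ≈⟨ ⊕-cong (S≋ (t x) (T.into x x∈)) (neg-cong t∘S≋) ⟩
    (S₁ (S₂ (t x)) ⊕ neg (S₂ (S₁ (t x)))) ⊕ neg (t (S₁ (S₂ x)) ⊕ neg (t (S₂ (S₁ x))))
      ≈⟨ ≋-solve 6 (λ a b c d e f → (a ⊞ ⊟ b) ⊞ ⊟ (f ⊞ ⊟ e)
                                   ⊜ ((a ⊞ ⊟ c) ⊞ ⊟ (d ⊞ ⊟ e)) ⊞ ⊟ ((b ⊞ ⊟ d) ⊞ ⊟ (c ⊞ ⊟ f)))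
           (λ _ → refl) (S₁ (S₂ (t x))) (S₂ (S₁ (t x))) (S₁ (t (S₂ x))) (S₂ (t (S₁ x)))
                        (t (S₂ (S₁ x))) (t (S₁ (S₂ x))) ⟩
    ((S₁ (S₂ (t x)) ⊕ neg (S₁ (t (S₂ x)))) ⊕ neg (S₂ (t (S₁ x)) ⊕ neg (t (S₂ (S₁ x)))))
      ⊕ neg ((S₂ (S₁ (t x)) ⊕ neg (S₂ (t (S₁ x)))) ⊕ neg (S₁ (t (S₂ x)) ⊕ neg (t (S₁ (S₂ x)))))
      ≈⟨ ⊕-cong (⊕-congˡ (neg (ad S₂ t (S₁ x))) (end-⊖ S₁-end (S₂ (t x)) (t (S₂ x)) S₂tx∈ tS₂x∈))
                (neg-cong (⊕-congˡ (neg (ad S₁ t (S₂ x))) (end-⊖ S₂-end (S₁ (t x)) (t (S₁ x)) S₁tx∈ tS₁x∈))) ⟨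
    ad S₁ (ad S₂ t) x ⊕ neg (ad S₂ (ad S₁ t) x) ∎
    where
    S₁S₂x∈ = S₁.into (S₂ x) (S₂.into x x∈)
    S₂S₁x∈ = S₂.into (S₁ x) (S₁.into x x∈)
    S₁tx∈ = S₁.into (t x) (T.into x x∈)
    S₂tx∈ = S₂.into (t x) (T.into x x∈)
    tS₁x∈ = T.into (S₁ x) (S₁.into x x∈)
    tS₂x∈ = T.into (S₂ x) (S₂.into x x∈)
    commutator∈ = In0-⊕ (S₁ (S₂ x)) (neg (S₂ (S₁ x))) S₁S₂x∈ (In0-· (- 1ℚ) (S₂ (S₁ x)) S₂S₁x∈)
    t∘S≋ : t (S x) ≋ t (S₁ (S₂ x)) ⊕ neg (t (S₂ (S₁ x)))
    t∘S≋ = begin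
      t (S x)
        ≈⟨ end-resp t-end (In0-resp (S≋ x x∈) commutator∈) commutator∈ (S≋ x x∈) ⟩
      t (S₁ (S₂ x) ⊕ neg (S₂ (S₁ x)))
        ≈⟨ end-⊖ t-end (S₁ (S₂ x)) (S₂ (S₁ x)) S₁S₂x∈ S₂S₁x∈ ⟩
      t (S₁ (S₂ x)) ⊕ neg (t (S₂ (S₁ x))) ∎

σ⁰-combination : ∀ a b ψ₁ ψ₂ x → σ⁰ (a · ψ₁ ⊕ b · ψ₂) x ≋ a · σ⁰ ψ₁ x ⊕ b · σ⁰ ψ₂ x
σ⁰-combination a b ψ₁ ψ₂ x = ≋-trans (⊕-hom L (a · ψ₁) (b · ψ₂)) (⊕-cong (·-hom L a ψ₁) (·-hom L b ψ₂))
  where L = σ⁰-linearˡ x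

lemma2p9 : (∀ (a b : ℚ) ψ₁ ψ₂ → IsLie ψ₁ → IsLie ψ₂ → ∀ t → IsEnd⁰ t → ∀ x → In0 x →
                Φ (a · ψ₁ ⊕ b · ψ₂) t x ≈ a · Φ ψ₁ t x ⊕ b · Φ ψ₂ t x)
             × (∀ ψ₁ ψ₂ → IsLie ψ₁ → IsLie ψ₂ → ∀ t → IsEnd⁰ t → ∀ x → In0 x →
                Φ (braceA ψ₁ ψ₂) t x ≈ Φ ψ₁ (Φ ψ₂ t) x ⊕ neg (Φ ψ₂ (Φ ψ₁ t) x))
lemma2p9 =
  (λ a b ψ₁ ψ₂ _ _ t t-end x x∈ → coeff-≡
    (ad-linear (σ⁰-end ψ₁) (σ⁰-end ψ₂) t-end a b (λ y _ → σ⁰-combination a b ψ₁ ψ₂ y) x x∈)) ,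
  (λ ψ₁ ψ₂ _ _ t t-end x x∈ → coeff-≡
    (ad-commutator (σ⁰-end ψ₁) (σ⁰-end ψ₂) t-end (λ y _ → σ⁰-braceA ψ₁ ψ₂ y) x x∈))
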